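{- For every set composition $\Phi$, \[ \rho(P_\Phi)=\sum_{\rho_I(\Phi)\le\alpha\le\rho_C(\Phi)}\mu(\alpha,\rho_C(\Phi))\,F_\alpha , \] where $\le$ is refinement order on compositions and $\mu$ is its Möbius function. Equivalently, $\mu(\alpha,\beta)=(-1)^{\ell(\alpha)-\ell(\beta)}$ for $\alpha\le\beta$, where $\ell$ denotes number of parts.
   Context: Set compositions and the basis $M_\Phi$: a set composition $\Phi=B_1|\cdots|B_k$ of $n$ is a sequence of disjoint nonempty sets with union $[n]$. $x_1,x_2,\ldots$ are non-commuting variables and $x_w=x_{w_1}\cdots x_{w_n}$. For a word $w$ with distinct values $v_1<\dots<v_k$, $\varrho(w)=B_1|\cdots|B_k$ with $B_r=\{i:w_i=v_r\}$, and $M_\Phi=\sum_{\varrho(w)=\Phi}x_w$. The power sums $P_\Phi$: order blocks by $A>_{\mathcal D}B$ if $|A|>|B|$, or $|A|=|B|$ and $\min A<\min B$ (a total order on disjoint nonempty sets). $\mathsf{LDD}(\Phi)$ is the set of placements of $B_i$ in row $i$ of a matrix such that the following hold. - $B_1$ is in column 1. - $B_{i+1}$ is in the same column as $B_i$ or the next column if $B_i>_{\mathcal D}B_{i+1}$, and in the next column otherwise. $\mathsf{col}$ lists, left to right, the unions of the nonempty columns. Then $P_\Phi=\sum_{\tilde{\mathsf F}\in\mathsf{LDD}(\Phi)}M_{\mathsf{col}(\tilde{\mathsf F})}$. Projection and QSym: $\rho(\Phi)=(|B_1|,\dots,|B_k|)$, and $\rho$ is extended linearly by $\rho(M_\Phi)=M_{\rho(\Phi)}$.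 Here $M_\gamma=\sum_{i_1<\dots<i_k}x_{i_1}^{c_1}\cdots x_{i_k}^{c_k}$ is the quasisymmetric monomial function in commuting variables. Refinement order: $\alpha\le\beta$ if $\beta$ is obtained from $\alpha$ by adding consecutive parts. The fundamental quasisymmetric function is $F_\beta=\sum_{\alpha\le\beta}M_\alpha$. The compositions $\rho_C$ and $\rho_I$: cut the sequence $\rho(\Phi)=(|B_1|,\dots,|B_k|)$ between positions $i$ and $i+1$ exactly when $B_i<_{\mathcal D}B_{i+1}$. This writes $\rho(\Phi)=\alpha_1|\cdots|\alpha_l$ as a concatenation of segments, where within each segment consecutive blocks decrease in $>_{\mathcal D}$. - $\rho_C(\Phi)=(|\alpha_1|,\dots,|\alpha_l|)$, where $|\alpha_i|$ is the sum of the parts of $\alpha_i$. - $\rho_I(\Phi)=\alpha_1'|\cdots|\alpha_l'$, where for a composition $\gamma$ of $m$, $\gamma'$ is the composition of $m$ whose set of partial sums in $[m-1]$ is the complement of that of $\gamma$. For example, $\rho_C(2|5|14|36|7)=(2,5)$ and $\rho_I(2|5|14|36|7)=(2,1,2,2)$. -}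

module Defs where

open import Data.Nat as ℕ using (ℕ; zero; suc; _+_; _∸_; _<ᵇ_; _≡ᵇ_)
open import Data.Integer as ℤ using (ℤ; +_; -_) renaming (_+_ to _+ℤ_; _^_ to _^ℤ_)
open import Data.Fin as Fin using (Fin; toℕ)
open import Data.List as List using (List; []; _∷_; [_]; map; concatMap; filter; length; allFin; upTo; _++_)
open import Data.Nat.ListAction using (sum)
open import Data.List.Properties using (≡-dec)
open import Data.Bool using (Bool; true; false; if_then_else_; _∧_; _∨_; not)
open import Data.Product using (∃; _×_; _,_)
open import Relation.Binary.PropositionalEquality using (_≡_)
open import Relation.Nullary.Decidable using (does; ⌊_⌋)
open import Data.List.Relation.Unary.Any using (any?)

-- Compositions (lists of positive naturals) and the refinement order

Composition : Set
Composition = List ℕ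

_≟C_ : (α β : Composition) → Relation.Nullary.Decidable.Dec (α ≡ β)
_≟C_ = ≡-dec ℕ._≟_

comps : ℕ → List Composition
comps zero = [ [] ]
comps (suc zero) = [ 1 ∷ [] ]
comps (suc (suc n)) = concatMap step (comps (suc n))
  where
  step : Composition → List Composition
  step [] = []
  step (a ∷ γ) = (1 ∷ a ∷ γ) ∷ (suc a ∷ γ) ∷ []

coarsenings : Composition → List Composition
coarsenings [] = [ [] ]
coarsenings (a ∷ α) = concatMap ext (coarsenings α)
  where
  ext : Composition → List Composition
  ext [] = [ a ∷ [] ]
  ext (g ∷ γ) = (a ∷ g ∷ γ) ∷ (a + g ∷ γ) ∷ []

_≤ᵇ_ : Composition → Composition → Bool
α ≤ᵇ β = does (any? (λ γ → γ ≟C β) (coarsenings α))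

ℓ : Composition → ℕ
ℓ = length

μ : Composition → Composition → ℤ
μ α β = (- (+ 1)) ^ℤ (ℓ α ∸ ℓ β)

-- QSym, represented in its monomial basis: an element is a finite formal
-- ℤ-linear combination  Σ c · M_γ  given as a list of (c , γ).

QSym : Set
QSym = List (ℤ × Composition)

coeff : Composition → QSym → ℤ
coeff γ [] = + 0
coeff γ ((c , δ) ∷ xs) = (if ⌊ δ ≟C γ ⌋ then c else + 0) +ℤ coeff γ xs

M : Composition → QSym
M γ = [ (+ 1 , γ) ]

scale : ℤ → QSym → QSym
scale c = map (λ { (d , γ) → (c ℤ.* d , γ) })

F : Composition → QSym
F β = concatMap M (filter (λ α → α ≤ᵇ β Data.Bool.≟ true) (comps (sum β)))

-- Set compositions of [n] = {0,…,n-1} (0-indexed) with k blocks: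
-- f : Fin n → Fin k, element x lies in block B_(f x); all blocks nonempty.

IsSetComposition : {n k : ℕ} → (Fin n → Fin k) → Set
IsSetComposition {n} {k} f = ∀ (i : Fin k) → ∃ λ (x : Fin n) → f x ≡ i

Block : ℕ → Set
Block n = List (Fin n)   -- elements in increasing order

block : {n k : ℕ} → (Fin n → Fin k) → Fin k → Block n
block f i = filter (λ x → f x Fin.≟ i) (allFin _)

blocks : {n k : ℕ} → (Fin n → Fin k) → List (Block n)
blocks f = map (block f) (allFin _)

minB : {n : ℕ} → Block n → ℕ
minB [] = 0
minB (x ∷ _) = toℕ x

_>D_ : {n : ℕ} → Block n → Block n → Bool
A >D B = (length B <ᵇ length A) ∨ ((length A ≡ᵇ length B) ∧ (minB A <ᵇ minB B))

ρ : {n k : ℕ} → (Fin n → Fin k) → Composition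
ρ f = map length (blocks f)

-- LDD(Φ): a placement is recorded as the list of columns c_1,…,c_k
-- (columns numbered from 1) of the rows B_1,…,B_k.

allowedCols : {n : ℕ} → ℕ → Block n → Block n → List ℕ
allowedCols c B B' = if B >D B' then c ∷ suc c ∷ [] else suc c ∷ []

lddFrom : {n : ℕ} → ℕ → Block n → List (Block n) → List (List ℕ)
lddFrom c B [] = [ [] ]
lddFrom c B (B' ∷ Bs) =
  concatMap (λ c' → map (c' ∷_) (lddFrom c' B' Bs)) (allowedCols c B B')

LDD : {n : ℕ} → List (Block n) → List (List ℕ)
LDD [] = [ [] ]
LDD (B ∷ Bs) = map (1 ∷_) (lddFrom 1 B Bs)

nth : List ℕ → ℕ → ℕ
nth [] _ = 0
nth (c ∷ cs) zero = c
nth (c ∷ cs) (suc i) = nth cs i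

-- ρ(col(F̃)): sizes of the nonempty columns' unions, left to right.
-- The union of column j is {x : column of the row of x = j}.
ρcol : {n k : ℕ} → (Fin n → Fin k) → List ℕ → Composition
ρcol {n} {k} f cs = filter (λ s → Relation.Nullary.Decidable.¬? (s ℕ.≟ 0))
                           (map colSize (List.map suc (upTo k)))
  where
  colOf : Fin n → ℕ
  colOf x = nth cs (toℕ (f x))
  colSize : ℕ → ℕ
  colSize j = length (filter (λ x → colOf x ℕ.≟ j) (allFin n))

ρP : {n k : ℕ} → (Fin n → Fin k) → QSym
ρP f = concatMap (λ cs → M (ρcol f cs)) (LDD (blocks f))

-- segments of the sequence of blocks: cut between B_i and B_(i+1)
-- exactly when B_i <_D B_(i+1), i.e. B_(i+1) >_D B_i
segments : {n : ℕ} → List (Block n) → List (List (Block n))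
segments [] = []
segments (B ∷ Bs) = go B [ B ] Bs
  where
  go : _ → List _ → List _ → List (List _)
  go prev cur [] = [ List.reverse cur ]
  go prev cur (B' ∷ Bs') =
    if B' >D prev then List.reverse cur ∷ go B' [ B' ] Bs'
                 else go B' (B' ∷ cur) Bs'

segSizes : {n k : ℕ} → (Fin n → Fin k) → List Composition
segSizes f = map (map length) (segments (blocks f))

ρC : {n k : ℕ} → (Fin n → Fin k) → Composition
ρC f = map sum (segSizes f)

partialSums : Composition → List ℕ
partialSums γ = go 0 γ
  where
  go : ℕ → Composition → List ℕ
  go acc [] = []
  go acc (a ∷ []) = []
  go acc (a ∷ b ∷ γ) = (acc + a) ∷ go (acc + a) (b ∷ γ)

-- composition of m with a given (increasing) set of partial sums in [m-1]
fromSet : ℕ → List ℕ → Composition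
fromSet m S = go 0 S
  where
  go : ℕ → List ℕ → Composition
  go prev [] = [ m ∸ prev ]
  go prev (s ∷ S) = (s ∸ prev) ∷ go s S

-- γ' : the composition of m = |γ| whose partial-sum set is the complement
complementC : Composition → Composition
complementC γ = fromSet m
  (filter (λ j → Relation.Nullary.Decidable.¬? (any? (λ s → s ℕ.≟ j) (partialSums γ)))
          (List.map suc (upTo (m ∸ 1))))
  where m = sum γ

ρI : {n k : ℕ} → (Fin n → Fin k) → Composition
ρI f = concatMap complementC (segSizes f)

rhs : {n k : ℕ} → (Fin n → Fin k) → QSym
rhs {n} f = concatMap (λ α → scale (μ α (ρC f)) (F α))
  (filter (λ α → ((ρI f ≤ᵇ α) ∧ (α ≤ᵇ ρC f)) Data.Bool.≟ true) (comps n))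

-- Encode a composition of m + 1 by the bit vector of length m marking its cuts; refinement becomes
-- reverse inclusion.  List the elements of B₁, …, B_k block after block: of the gaps between consecutive
-- elements, the inner ones lie inside a block and the others separate two blocks, a boundary starting a
-- new segment when B_i <_D B_(i+1).  Then ρ_C cuts exactly at the segment starts, and ρ_I at the segment
-- starts and the inner gaps.  On the left, an LDD placement chooses at each boundary whether the next
-- block moves to a new column (forced at a segment start), and ρ(col) glues the block sizes accordingly.
-- On the right, expanding F_α and exchanging the sums, the coefficient of M_w is an alternating sum over
-- the cut sets a with ρ_C ⊆ a ⊆ ρ_I and a ⊆ w; it factorises over the gaps and equals 1 exactly when w
-- has no cut at the inner gaps and one at every segment start, i.e. when w is the column composition of
-- a placement.
module Submission where

open import Defs

import Algebra.Properties.CommutativeMonoid.Sum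
open import Data.Bool as Bool using (Bool; true; false; not; _∧_; _∨_; if_then_else_)
import Data.Bool.Properties as Bool
open import Data.Bool.ListAction using (any)
open import Data.Empty using (⊥-elim)
open import Data.Fin as Fin using (Fin; toℕ)
open import Data.Fin.Properties using (toℕ-injective)
open import Data.Integer as ℤ using (ℤ; +_)
  renaming (_+_ to _+ℤ_; _*_ to _*ℤ_; _^_ to _^ℤ_)
import Data.Integer.Properties as ℤ
open import Data.Integer.Tactic.RingSolver using (solve-∀)
open import Data.List as List
  using (List; []; _∷_; _++_; map; concatMap; length; filter; replicate)
import Data.List.Properties as List
open import Data.List.Membership.Propositional using (_∈_)
open import Data.List.Membership.Propositional.Properties using (∈-allFin; ∈-filter⁻)
open import Data.List.Relation.Unary.All as All using (All)
open import Data.List.Relation.Unary.Any as Any using (Any; any?; here)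
open import Data.List.Relation.Unary.Linked as Linked using (Linked)
open import Data.List.Relation.Unary.Linked.Properties using (AllPairs⇒Linked)
open import Data.List.Relation.Unary.Unique.Propositional.Properties using (allFin⁺)
open import Data.Nat as ℕ using (ℕ; zero; suc; _+_; _∸_; _<_; _≤_; z≤n; s≤s; pred)
import Data.Nat.Properties as ℕ
open import Data.Nat.ListAction using (sum)
open import Data.Product using (Σ; _×_; _,_; proj₁; proj₂)
open import Data.Unit using (⊤; tt)
open import Function.Bundles using (mk⇔)
open import Relation.Binary.Definitions using (DecidableEquality)
open import Relation.Binary.PropositionalEquality
open import Relation.Nullary using (does; ¬_; ¬?)
open import Relation.Nullary.Decidable using (does-⇔; dec-true; dec-false; ⌊_⌋)
open import Relation.Unary using (Decidable)

module FinSum = Algebra.Properties.CommutativeMonoid.Sum ℕ.+-0-commutativeMonoid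

-- Sums over lists and over bit vectors

𝟙 : Bool → ℤ
𝟙 true = + 1
𝟙 false = + 0

𝟙-∧ : ∀ x y → 𝟙 (x ∧ y) ≡ 𝟙 x *ℤ 𝟙 y
𝟙-∧ true y = sym (ℤ.*-identityˡ (𝟙 y))
𝟙-∧ false y = refl

∑ : {A : Set} → List A → (A → ℤ) → ℤ
∑ [] g = + 0
∑ (x ∷ xs) g = g x +ℤ ∑ xs g

∑-++ : {A : Set} (xs ys : List A) (g : A → ℤ) → ∑ (xs ++ ys) g ≡ ∑ xs g +ℤ ∑ ys g
∑-++ [] ys g = sym (ℤ.+-identityˡ _)
∑-++ (x ∷ xs) ys g = trans (cong (g x +ℤ_) (∑-++ xs ys g)) (sym (ℤ.+-assoc (g x) _ _))

∑-map : {A B : Set} (h : A → B) (xs : List A) (g : B → ℤ) → ∑ (map h xs) g ≡ ∑ xs (λ x → g (h x))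
∑-map h [] g = refl
∑-map h (x ∷ xs) g = cong (g (h x) +ℤ_) (∑-map h xs g)

∑-concatMap : {A B : Set} (h : A → List B) (xs : List A) (g : B → ℤ) →
  ∑ (concatMap h xs) g ≡ ∑ xs (λ x → ∑ (h x) g)
∑-concatMap h [] g = refl
∑-concatMap h (x ∷ xs) g = trans (∑-++ (h x) (concatMap h xs) g) (cong (∑ (h x) g +ℤ_) (∑-concatMap h xs g))

∑-filter : {A : Set} (p : A → Bool) (xs : List A) (g : A → ℤ) →
  ∑ (filter (λ x → p x Bool.≟ true) xs) g ≡ ∑ xs (λ x → 𝟙 (p x) *ℤ g x)
∑-filter p [] g = refl
∑-filter p (x ∷ xs) g with p x
... | true = cong₂ _+ℤ_ (sym (ℤ.*-identityˡ (g x))) (∑-filter p xs g)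
... | false = trans (∑-filter p xs g) (sym (ℤ.+-identityˡ _))

∑𝔹 : ℕ → (List Bool → ℤ) → ℤ
∑𝔹 zero g = g []
∑𝔹 (suc m) g = ∑𝔹 m (λ v → g (true ∷ v) +ℤ g (false ∷ v))

∑𝔹-cong : ∀ m {f g : List Bool → ℤ} → (∀ v → f v ≡ g v) → ∑𝔹 m f ≡ ∑𝔹 m g
∑𝔹-cong zero f≗g = f≗g []
∑𝔹-cong (suc m) f≗g = ∑𝔹-cong m (λ v → cong₂ _+ℤ_ (f≗g (true ∷ v)) (f≗g (false ∷ v)))

∑𝔹-congᴸ : ∀ m {f g : List Bool → ℤ} → (∀ v → length v ≡ m → f v ≡ g v) → ∑𝔹 m f ≡ ∑𝔹 m g
∑𝔹-congᴸ zero f≗g = f≗g [] refl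
∑𝔹-congᴸ (suc m) f≗g =
  ∑𝔹-congᴸ m (λ v e → cong₂ _+ℤ_ (f≗g (true ∷ v) (cong suc e)) (f≗g (false ∷ v) (cong suc e)))

∑𝔹-+ : ∀ m (f g : List Bool → ℤ) → ∑𝔹 m (λ v → f v +ℤ g v) ≡ ∑𝔹 m f +ℤ ∑𝔹 m g
∑𝔹-+ zero f g = refl
∑𝔹-+ (suc m) f g =
  trans (∑𝔹-cong m (λ v → interchange (f (true ∷ v)) (g (true ∷ v)) (f (false ∷ v)) (g (false ∷ v))))
        (∑𝔹-+ m _ _)
  where
  interchange : ∀ a b c d → (a +ℤ b) +ℤ (c +ℤ d) ≡ (a +ℤ c) +ℤ (b +ℤ d)
  interchange = solve-∀

∑𝔹-*ˡ : ∀ m (c : ℤ) (f : List Bool → ℤ) → ∑𝔹 m (λ v → c *ℤ f v) ≡ c *ℤ ∑𝔹 m f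
∑𝔹-*ˡ zero c f = refl
∑𝔹-*ˡ (suc m) c f =
  trans (∑𝔹-cong m (λ v → sym (ℤ.*-distribˡ-+ c (f (true ∷ v)) (f (false ∷ v))))) (∑𝔹-*ˡ m c _)

∑𝔹-swap : ∀ m m′ (G : List Bool → List Bool → ℤ) →
  ∑𝔹 m (λ a → ∑𝔹 m′ (G a)) ≡ ∑𝔹 m′ (λ w → ∑𝔹 m (λ a → G a w))
∑𝔹-swap zero m′ G = refl
∑𝔹-swap (suc m) m′ G =
  trans (∑𝔹-cong m (λ a → sym (∑𝔹-+ m′ (G (true ∷ a)) (G (false ∷ a)))))
        (∑𝔹-swap m m′ (λ a w → G (true ∷ a) w +ℤ G (false ∷ a) w))

branch : List Bool → List (List Bool)
branch v = (true ∷ v) ∷ (false ∷ v) ∷ []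

bitVectors : ℕ → List (List Bool)
bitVectors zero = [] ∷ []
bitVectors (suc m) = concatMap branch (bitVectors m)

∑-bitVectors : ∀ m (g : List Bool → ℤ) → ∑ (bitVectors m) g ≡ ∑𝔹 m g
∑-bitVectors zero g = ℤ.+-identityʳ (g [])
∑-bitVectors (suc m) g =
  trans (∑-concatMap _ (bitVectors m) g)
  (trans (∑-bitVectors m _) (∑𝔹-cong m (λ v → cong (g (true ∷ v) +ℤ_) (ℤ.+-identityʳ (g (false ∷ v))))))

-- Compositions as cut vectors

incHead : Composition → Composition
incHead [] = []
incHead (a ∷ γ) = suc a ∷ γ

fromCuts : List Bool → Composition
fromCuts [] = 1 ∷ []
fromCuts (true ∷ v) = 1 ∷ fromCuts v
fromCuts (false ∷ v) = incHead (fromCuts v)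

fromCuts-cons : ∀ v → Σ ℕ λ a → Σ Composition λ γ → fromCuts v ≡ suc a ∷ γ
fromCuts-cons [] = 0 , [] , refl
fromCuts-cons (true ∷ v) = 0 , fromCuts v , refl
fromCuts-cons (false ∷ v) with fromCuts-cons v
... | a , γ , e = suc a , γ , cong incHead e

split-fromCuts : {g : Composition → List Composition} →
  (∀ a γ → g (a ∷ γ) ≡ (1 ∷ a ∷ γ) ∷ (suc a ∷ γ) ∷ []) →
  ∀ vs → concatMap g (map fromCuts vs) ≡ map fromCuts (concatMap branch vs)
split-fromCuts g-split [] = refl
split-fromCuts {g} g-split (v ∷ vs) with fromCuts-cons v | split-fromCuts {g} g-split vs
... | a , γ , e | ih rewrite e | g-split (suc a) γ =
  cong (λ rest → (1 ∷ suc a ∷ γ) ∷ (suc (suc a) ∷ γ) ∷ rest) ih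

comps-fromCuts : ∀ m → comps (suc m) ≡ map fromCuts (bitVectors m)
comps-fromCuts zero = refl
comps-fromCuts (suc m) rewrite comps-fromCuts m = split-fromCuts (λ a γ → refl) (bitVectors m)

subsets : List Bool → List (List Bool)
subsets [] = [] ∷ []
subsets (true ∷ u) = concatMap branch (subsets u)
subsets (false ∷ u) = map (false ∷_) (subsets u)

concatMap-incHead : {g h : Composition → List Composition} → (∀ δ → g δ ≡ map incHead (h δ)) →
  ∀ δs → concatMap g δs ≡ map incHead (concatMap h δs)
concatMap-incHead g≗h [] = refl
concatMap-incHead {g} {h} g≗h (δ ∷ δs) =
  trans (cong₂ _++_ (g≗h δ) (concatMap-incHead {g} {h} g≗h δs))
        (sym (List.map-++ incHead (h δ) (concatMap h δs)))

coarsenings-incHead : ∀ a γ → coarsenings (suc a ∷ γ) ≡ map incHead (coarsenings (a ∷ γ))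
coarsenings-incHead a γ = concatMap-incHead (λ { [] → refl ; (_ ∷ _) → refl }) (coarsenings γ)

coarsenings-fromCuts : ∀ u → coarsenings (fromCuts u) ≡ map fromCuts (subsets u)
coarsenings-fromCuts [] = refl
coarsenings-fromCuts (true ∷ u) rewrite coarsenings-fromCuts u = split-fromCuts (λ a γ → refl) (subsets u)
coarsenings-fromCuts (false ∷ u) with fromCuts-cons u | coarsenings-fromCuts u
... | a , γ , e | ih rewrite e =
  trans (coarsenings-incHead (suc a) γ)
  (trans (cong (map incHead) ih) (trans (sym (List.map-∘ (subsets u))) (List.map-∘ (subsets u))))

incHead-injective : ∀ {a b γ δ} → incHead (suc a ∷ γ) ≡ incHead (suc b ∷ δ) → suc a ∷ γ ≡ suc b ∷ δ
incHead-injective refl = refl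

[1]≢fromCuts-true : ∀ v → (1 ∷ []) ≢ fromCuts (true ∷ v)
[1]≢fromCuts-true v e with fromCuts-cons v
... | a , δ , e′ with trans (List.∷-injectiveʳ e) e′
... | ()

1∷≢fromCuts-false : ∀ γ v → 1 ∷ γ ≢ fromCuts (false ∷ v)
1∷≢fromCuts-false γ v e with fromCuts-cons v
... | a , δ , e′ with trans e (cong incHead e′)
... | ()

fromCuts-injective : ∀ v u → fromCuts v ≡ fromCuts u → v ≡ u
fromCuts-injective [] [] e = refl
fromCuts-injective [] (true ∷ u) e = ⊥-elim ([1]≢fromCuts-true u e)
fromCuts-injective [] (false ∷ u) e = ⊥-elim (1∷≢fromCuts-false [] u e)
fromCuts-injective (true ∷ v) [] e = ⊥-elim ([1]≢fromCuts-true v (sym e))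
fromCuts-injective (true ∷ v) (true ∷ u) e = cong (true ∷_) (fromCuts-injective v u (List.∷-injectiveʳ e))
fromCuts-injective (true ∷ v) (false ∷ u) e = ⊥-elim (1∷≢fromCuts-false (fromCuts v) u e)
fromCuts-injective (false ∷ v) [] e = ⊥-elim (1∷≢fromCuts-false [] v (sym e))
fromCuts-injective (false ∷ v) (true ∷ u) e = ⊥-elim (1∷≢fromCuts-false (fromCuts u) v (sym e))
fromCuts-injective (false ∷ v) (false ∷ u) e with fromCuts-cons v | fromCuts-cons u
... | a , γ , ev | b , δ , eu = cong (false ∷_) (fromCuts-injective v u
  (trans ev (trans (incHead-injective (trans (cong incHead (sym ev)) (trans e (cong incHead eu)))) (sym eu))))

_⇒ᵇ_ : Bool → Bool → Bool
true ⇒ᵇ c = c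
false ⇒ᵇ c = true

_⊆ᵇ_ : List Bool → List Bool → Bool
[] ⊆ᵇ [] = true
(b ∷ u) ⊆ᵇ (c ∷ w) = (b ⇒ᵇ c) ∧ (u ⊆ᵇ w)
_ ⊆ᵇ _ = false

_≟𝔹_ : DecidableEquality (List Bool)
_≟𝔹_ = List.≡-dec Bool._≟_

any?-does : {A : Set} {P : A → Set} (P? : Decidable P) (xs : List A) →
  does (any? P? xs) ≡ any (λ x → does (P? x)) xs
any?-does P? [] = refl
any?-does P? (x ∷ xs) = cong (does (P? x) ∨_) (any?-does P? xs)

any-map : {A B : Set} (p : B → Bool) (h : A → B) (xs : List A) → any p (map h xs) ≡ any (λ x → p (h x)) xs
any-map p h [] = refl
any-map p h (x ∷ xs) = cong (p (h x) ∨_) (any-map p h xs)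

any-++ : {A : Set} (p : A → Bool) (xs ys : List A) → any p (xs ++ ys) ≡ any p xs ∨ any p ys
any-++ p [] ys = refl
any-++ p (x ∷ xs) ys = trans (cong (p x ∨_) (any-++ p xs ys)) (sym (Bool.∨-assoc (p x) _ _))

any-concatMap : {A B : Set} (p : B → Bool) (h : A → List B) (xs : List A) →
  any p (concatMap h xs) ≡ any (λ x → any p (h x)) xs
any-concatMap p h [] = refl
any-concatMap p h (x ∷ xs) = trans (any-++ p (h x) (concatMap h xs)) (cong (any p (h x) ∨_) (any-concatMap p h xs))

any-cong : {A : Set} {p q : A → Bool} (xs : List A) → (∀ x → p x ≡ q x) → any p xs ≡ any q xs
any-cong [] p≗q = refl
any-cong (x ∷ xs) p≗q = cong₂ _∨_ (p≗q x) (any-cong xs p≗q)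

any-false : {A : Set} (xs : List A) → any (λ _ → false) xs ≡ false
any-false [] = refl
any-false (x ∷ xs) = any-false xs

any-subsets : ∀ u w → any (λ v → does (v ≟𝔹 u)) (subsets w) ≡ u ⊆ᵇ w
any-subsets [] [] = refl
any-subsets (c ∷ u) [] = refl
any-subsets [] (true ∷ w) = trans (any-concatMap _ branch (subsets w)) (any-false (subsets w))
any-subsets [] (false ∷ w) = trans (any-map _ _ (subsets w)) (any-false (subsets w))
any-subsets (true ∷ u) (true ∷ w) =
  trans (any-concatMap _ branch (subsets w))
  (trans (any-cong (subsets w) (λ v → Bool.∨-identityʳ _)) (any-subsets u w))
any-subsets (false ∷ u) (true ∷ w) =
  trans (any-concatMap _ branch (subsets w))
  (trans (any-cong (subsets w) (λ v → Bool.∨-identityʳ _)) (any-subsets u w))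
any-subsets (true ∷ u) (false ∷ w) = trans (any-map _ _ (subsets w)) (any-false (subsets w))
any-subsets (false ∷ u) (false ∷ w) = trans (any-map _ _ (subsets w)) (any-subsets u w)

≤ᵇ-fromCuts : ∀ w u → (fromCuts w ≤ᵇ fromCuts u) ≡ u ⊆ᵇ w
≤ᵇ-fromCuts w u = begin
  does (any? (_≟C fromCuts u) (coarsenings (fromCuts w)))
    ≡⟨ cong (λ γs → does (any? (_≟C fromCuts u) γs)) (coarsenings-fromCuts w) ⟩
  does (any? (_≟C fromCuts u) (map fromCuts (subsets w)))
    ≡⟨ any?-does (_≟C fromCuts u) (map fromCuts (subsets w)) ⟩
  any (λ γ → does (γ ≟C fromCuts u)) (map fromCuts (subsets w))
    ≡⟨ any-map _ fromCuts (subsets w) ⟩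
  any (λ v → does (fromCuts v ≟C fromCuts u)) (subsets w)
    ≡⟨ any-cong (subsets w) (λ v → does-⇔ (mk⇔ (fromCuts-injective v u) (cong fromCuts)) (fromCuts v ≟C fromCuts u) (v ≟𝔹 u)) ⟩
  any (λ v → does (v ≟𝔹 u)) (subsets w)
    ≡⟨ any-subsets u w ⟩
  u ⊆ᵇ w ∎
  where open ≡-Reasoning

length-incHead : ∀ γ → length (incHead γ) ≡ length γ
length-incHead [] = refl
length-incHead (a ∷ γ) = refl

#trues : List Bool → ℕ
#trues [] = 0
#trues (true ∷ v) = suc (#trues v)
#trues (false ∷ v) = #trues v

length-fromCuts : ∀ v → length (fromCuts v) ≡ suc (#trues v)
length-fromCuts [] = refl
length-fromCuts (true ∷ v) = cong suc (length-fromCuts v)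
length-fromCuts (false ∷ v) = trans (length-incHead (fromCuts v)) (length-fromCuts v)

sum-fromCuts : ∀ v → sum (fromCuts v) ≡ suc (length v)
sum-fromCuts [] = refl
sum-fromCuts (true ∷ v) = cong suc (sum-fromCuts v)
sum-fromCuts (false ∷ v) with fromCuts-cons v | sum-fromCuts v
... | a , γ , e | ih rewrite e = cong suc ih

fromCuts-++ : ∀ u v → fromCuts u ++ fromCuts v ≡ fromCuts (u ++ true ∷ v)
fromCuts-++ [] v = refl
fromCuts-++ (true ∷ u) v = cong (1 ∷_) (fromCuts-++ u v)
fromCuts-++ (false ∷ u) v with fromCuts-cons u | fromCuts-++ u v
... | a , γ , e | ih rewrite e = cong incHead ih

-- The local helpers `go` of `partialSums`, `fromSet` and `segments` in Defs cannot be referred to by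
-- name.  Each is captured as a metavariable, solved by unifying an unfolding of its caller; the `with`
-- generalises the arguments to variables so that the unification problem is a pattern.
mutual
  partialSumsGo : Composition → ℕ → Composition → List ℕ
  partialSumsGo = _

  partialSums-unfold : ∀ a b δ → partialSums (a ∷ b ∷ δ) ≡ a ∷ partialSumsGo (a ∷ b ∷ δ) a (b ∷ δ)
  partialSums-unfold a b δ with b ∷ δ | a ∷ b ∷ δ
  ... | _ | _ = refl

mutual
  fromSetGo : ℕ → List ℕ → ℕ → List ℕ → Composition
  fromSetGo = _

  fromSet-unfold : ∀ m s S → fromSet m (s ∷ S) ≡ (s ∸ 0) ∷ fromSetGo m (s ∷ S) s S
  fromSet-unfold m s S with S | s ∷ S
  ... | _ | _ = refl

mutual
  segmentsGo : {n : ℕ} → Block n → List (Block n) → Block n → List (Block n) → List (Block n) → List (List (Block n))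
  segmentsGo = _

  segments-unfold : ∀ {n} (B B′ : Block n) Bs → segments (B ∷ B′ ∷ Bs) ≡
    (if B′ >D B then List.reverse (B ∷ []) ∷ segmentsGo B (B′ ∷ Bs) B′ (B′ ∷ []) Bs
     else segmentsGo B (B′ ∷ Bs) B′ (B′ ∷ B ∷ []) Bs)
  segments-unfold B B′ Bs with B′ ∷ Bs | B′ ∷ [] | B′ ∷ B ∷ []
  ... | _ | _ | _ = refl

partialSumsFrom : ℕ → Composition → List ℕ
partialSumsFrom o [] = []
partialSumsFrom o (a ∷ []) = []
partialSumsFrom o (a ∷ b ∷ γ) = (o + a) ∷ partialSumsFrom (o + a) (b ∷ γ)

partialSumsGo≗partialSumsFrom : ∀ γ₀ o γ → partialSumsGo γ₀ o γ ≡ partialSumsFrom o γ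
partialSumsGo≗partialSumsFrom γ₀ o [] = refl
partialSumsGo≗partialSumsFrom γ₀ o (a ∷ []) = refl
partialSumsGo≗partialSumsFrom γ₀ o (a ∷ b ∷ γ) = cong ((o + a) ∷_) (partialSumsGo≗partialSumsFrom γ₀ (o + a) (b ∷ γ))

partialSums≡partialSumsFrom0 : ∀ γ → partialSums γ ≡ partialSumsFrom 0 γ
partialSums≡partialSumsFrom0 [] = refl
partialSums≡partialSumsFrom0 (a ∷ []) = refl
partialSums≡partialSumsFrom0 (a ∷ b ∷ δ) =
  trans (partialSums-unfold a b δ) (cong (a ∷_) (partialSumsGo≗partialSumsFrom (a ∷ b ∷ δ) a (b ∷ δ)))

fromSetFrom : ℕ → ℕ → List ℕ → Composition
fromSetFrom m p [] = m ∸ p ∷ []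
fromSetFrom m p (s ∷ S) = (s ∸ p) ∷ fromSetFrom m s S

fromSetGo≗fromSetFrom : ∀ m S₀ p S → fromSetGo m S₀ p S ≡ fromSetFrom m p S
fromSetGo≗fromSetFrom m S₀ p [] = refl
fromSetGo≗fromSetFrom m S₀ p (s ∷ S) = cong ((s ∸ p) ∷_) (fromSetGo≗fromSetFrom m S₀ s S)

fromSet≡fromSetFrom0 : ∀ m S → fromSet m S ≡ fromSetFrom m 0 S
fromSet≡fromSetFrom0 m [] = refl
fromSet≡fromSetFrom0 m (s ∷ S) = trans (fromSet-unfold m s S) (cong (s ∷_) (fromSetGo≗fromSetFrom m (s ∷ S) s S))

-- Complementary compositions

cutPositions : ℕ → List Bool → List ℕ
cutPositions o [] = []
cutPositions o (true ∷ v) = suc o ∷ cutPositions (suc o) v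
cutPositions o (false ∷ v) = cutPositions (suc o) v

partialSumsFrom-incHead : ∀ o a γ → partialSumsFrom o (suc a ∷ γ) ≡ partialSumsFrom (suc o) (a ∷ γ)
partialSumsFrom-incHead o a [] = refl
partialSumsFrom-incHead o a (b ∷ γ) rewrite ℕ.+-suc o a = refl

partialSumsFrom-fromCuts : ∀ o v → partialSumsFrom o (fromCuts v) ≡ cutPositions o v
partialSumsFrom-fromCuts o [] = refl
partialSumsFrom-fromCuts o (true ∷ v) with fromCuts-cons v | partialSumsFrom-fromCuts (suc o) v
... | a , γ , e | ih rewrite e | ℕ.+-comm o 1 = cong (suc o ∷_) ih
partialSumsFrom-fromCuts o (false ∷ v) with fromCuts-cons v | partialSumsFrom-fromCuts (suc o) v
... | a , γ , e | ih rewrite e = trans (partialSumsFrom-incHead o (suc a) γ) ih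

_∈ᵇ_ : ℕ → List ℕ → Bool
j ∈ᵇ S = any (λ s → does (s ℕ.≟ j)) S

range : ℕ → ℕ → List ℕ
range c zero = []
range c (suc l) = c ∷ range (suc c) l

map-suc-upTo : ∀ l → map suc (List.upTo l) ≡ range 1 l
map-suc-upTo l = trans (List.map-applyUpTo (λ i → i) suc l) (go l 1 suc (λ i → refl))
  where
  go : ∀ l c (f : ℕ → ℕ) → (∀ i → f i ≡ c + i) → List.applyUpTo f l ≡ range c l
  go zero c f f≗c+ = refl
  go (suc l) c f f≗c+ = cong₂ _∷_ (trans (f≗c+ 0) (ℕ.+-identityʳ c))
    (go l (suc c) (λ i → f (suc i)) (λ i → trans (f≗c+ (suc i)) (ℕ.+-suc c i)))

filter-does : {A : Set} {P : A → Set} (P? : Decidable P) (xs : List A) →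
  filter P? xs ≡ List.filterᵇ (λ x → does (P? x)) xs
filter-does P? [] = refl
filter-does P? (x ∷ xs) with does (P? x)
... | true = cong (x ∷_) (filter-does P? xs)
... | false = filter-does P? xs

filterᵇ-cong-range : ∀ {p q : ℕ → Bool} l c → (∀ j → c ≤ j → p j ≡ q j) →
  List.filterᵇ p (range c l) ≡ List.filterᵇ q (range c l)
filterᵇ-cong-range zero c p≗q = refl
filterᵇ-cong-range {p} {q} (suc l) c p≗q rewrite p≗q c ℕ.≤-refl with q c
... | true = cong (c ∷_) (filterᵇ-cong-range l (suc c) (λ j c<j → p≗q j (ℕ.<⇒≤ c<j)))
... | false = filterᵇ-cong-range l (suc c) (λ j c<j → p≗q j (ℕ.<⇒≤ c<j))

filterᵇ-∷ : {A : Set} (p : A → Bool) (x : A) (xs : List A) →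
  List.filterᵇ p (x ∷ xs) ≡ (if p x then x ∷ List.filterᵇ p xs else List.filterᵇ p xs)
filterᵇ-∷ p x xs with p x
... | true = refl
... | false = refl

∈ᵇ-cutPositions-≤ : ∀ j o v → j ≤ o → (j ∈ᵇ cutPositions o v) ≡ false
∈ᵇ-cutPositions-≤ j o [] j≤o = refl
∈ᵇ-cutPositions-≤ j o (true ∷ v) j≤o =
  cong₂ _∨_ (dec-false (suc o ℕ.≟ j) (λ e → ℕ.<-irrefl (sym e) (s≤s j≤o)))
            (∈ᵇ-cutPositions-≤ j (suc o) v (ℕ.m≤n⇒m≤1+n j≤o))
∈ᵇ-cutPositions-≤ j o (false ∷ v) j≤o = ∈ᵇ-cutPositions-≤ j (suc o) v (ℕ.m≤n⇒m≤1+n j≤o)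

∈ᵇ-cutPositions-∷ : ∀ j o b v → suc o < j → (j ∈ᵇ cutPositions o (b ∷ v)) ≡ (j ∈ᵇ cutPositions (suc o) v)
∈ᵇ-cutPositions-∷ j o true v 1+o<j = cong (_∨ (j ∈ᵇ cutPositions (suc o) v)) (dec-false (suc o ℕ.≟ j) (λ e → ℕ.<-irrefl e 1+o<j))
∈ᵇ-cutPositions-∷ j o false v 1+o<j = refl

filterᵇ-cutPositions : ∀ o v →
  List.filterᵇ (λ j → not (j ∈ᵇ cutPositions o v)) (range (suc o) (length v)) ≡ cutPositions o (map not v)
filterᵇ-cutPositions o [] = refl
filterᵇ-cutPositions o (b ∷ v) = begin
  List.filterᵇ P (suc o ∷ range (suc (suc o)) (length v))
    ≡⟨ filterᵇ-∷ P (suc o) _ ⟩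
  (if P (suc o) then suc o ∷ List.filterᵇ P rest else List.filterᵇ P rest)
    ≡⟨ cong (λ X → if P (suc o) then suc o ∷ X else X) tail ⟩
  (if P (suc o) then suc o ∷ cutPositions (suc o) (map not v) else cutPositions (suc o) (map not v))
    ≡⟨ head b ⟩
  cutPositions o (not b ∷ map not v) ∎
  where
  open ≡-Reasoning
  P : ℕ → Bool
  P j = not (j ∈ᵇ cutPositions o (b ∷ v))
  rest : List ℕ
  rest = range (suc (suc o)) (length v)
  tail : List.filterᵇ P rest ≡ cutPositions (suc o) (map not v)
  tail = trans (filterᵇ-cong-range (length v) (suc (suc o)) (λ j 1+o<j → cong not (∈ᵇ-cutPositions-∷ j o b v 1+o<j)))
               (filterᵇ-cutPositions (suc o) v)
  head : ∀ b → (if not (suc o ∈ᵇ cutPositions o (b ∷ v)) then suc o ∷ cutPositions (suc o) (map not v)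
                else cutPositions (suc o) (map not v)) ≡ cutPositions o (not b ∷ map not v)
  head true rewrite dec-true (suc o ℕ.≟ suc o) refl = refl
  head false rewrite ∈ᵇ-cutPositions-≤ (suc o) (suc o) v ℕ.≤-refl = refl

cutPositions-> : ∀ o v → All (o <_) (cutPositions o v)
cutPositions-> o [] = All.[]
cutPositions-> o (true ∷ v) = ℕ.≤-refl All.∷ All.map (ℕ.<-trans (ℕ.n<1+n o)) (cutPositions-> (suc o) v)
cutPositions-> o (false ∷ v) = All.map (ℕ.<-trans (ℕ.n<1+n o)) (cutPositions-> (suc o) v)

m∸n≡1+m∸1+n : ∀ m n → n < m → m ∸ n ≡ suc (m ∸ suc n)
m∸n≡1+m∸1+n (suc m) zero n<m = refl
m∸n≡1+m∸1+n (suc m) (suc n) (s≤s n<m) = m∸n≡1+m∸1+n m n n<m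

fromSetFrom-incHead : ∀ m o S → o < m → All (o <_) S → fromSetFrom m o S ≡ incHead (fromSetFrom m (suc o) S)
fromSetFrom-incHead m o [] o<m _ = cong (_∷ []) (m∸n≡1+m∸1+n m o o<m)
fromSetFrom-incHead m o (s ∷ S) o<m (o<s All.∷ _) = cong (_∷ fromSetFrom m s S) (m∸n≡1+m∸1+n s o o<s)

fromSetFrom-cutPositions : ∀ m o u → m ≡ o + suc (length u) → fromSetFrom m o (cutPositions o u) ≡ fromCuts u
fromSetFrom-cutPositions m o [] refl = cong (_∷ []) (ℕ.m+n∸m≡n o 1)
fromSetFrom-cutPositions m o (true ∷ u) m≡ =
  cong₂ _∷_ (ℕ.m+n∸n≡m 1 o) (fromSetFrom-cutPositions m (suc o) u (trans m≡ (ℕ.+-suc o (suc (length u)))))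
fromSetFrom-cutPositions m o (false ∷ u) m≡ =
  trans (fromSetFrom-incHead m o (cutPositions (suc o) u) o<m
           (All.map (ℕ.<-trans (ℕ.n<1+n o)) (cutPositions-> (suc o) u)))
        (cong incHead (fromSetFrom-cutPositions m (suc o) u (trans m≡ (ℕ.+-suc o (suc (length u))))))
  where
  o<m : o < m
  o<m rewrite m≡ = ℕ.m<m+n o (s≤s z≤n)

complementC-fromCuts : ∀ v → complementC (fromCuts v) ≡ fromCuts (map not v)
complementC-fromCuts v = begin
  fromSet (sum (fromCuts v)) (filter notCut (map suc (List.upTo (sum (fromCuts v) ∸ 1))))
    ≡⟨ cong (λ m → fromSet m (filter notCut (map suc (List.upTo (m ∸ 1))))) (sum-fromCuts v) ⟩
  fromSet (suc l) (filter notCut (map suc (List.upTo l)))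
    ≡⟨ cong (fromSet (suc l)) cuts ⟩
  fromSet (suc l) (cutPositions 0 (map not v))
    ≡⟨ fromSet≡fromSetFrom0 (suc l) _ ⟩
  fromSetFrom (suc l) 0 (cutPositions 0 (map not v))
    ≡⟨ fromSetFrom-cutPositions (suc l) 0 (map not v) (cong suc (sym (List.length-map not v))) ⟩
  fromCuts (map not v) ∎
  where
  open ≡-Reasoning
  l : ℕ
  l = length v
  notCut : Decidable (λ j → ¬ Any (_≡ j) (partialSums (fromCuts v)))
  notCut j = ¬? (any? (ℕ._≟ j) (partialSums (fromCuts v)))
  cuts : filter notCut (map suc (List.upTo l)) ≡ cutPositions 0 (map not v)
  cuts = begin
    filter notCut (map suc (List.upTo l))
      ≡⟨ filter-does notCut (map suc (List.upTo l)) ⟩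
    List.filterᵇ (λ j → does (notCut j)) (map suc (List.upTo l))
      ≡⟨ cong (List.filterᵇ _) (map-suc-upTo l) ⟩
    List.filterᵇ (λ j → does (notCut j)) (range 1 l)
      ≡⟨ filterᵇ-cong-range l 1 (λ j _ → cong not (trans (any?-does (ℕ._≟ j) (partialSums (fromCuts v)))
           (cong (j ∈ᵇ_) (trans (partialSums≡partialSumsFrom0 (fromCuts v)) (partialSumsFrom-fromCuts 0 v))))) ⟩
    List.filterᵇ (λ j → not (j ∈ᵇ cutPositions 0 v)) (range 1 l)
      ≡⟨ filterᵇ-cutPositions 0 v ⟩
    cutPositions 0 (map not v) ∎

-- Segments and the gaps between blocks

segmentsFrom : {n : ℕ} → Block n → List (Block n) → List (Block n) → List (List (Block n))
segmentsFrom prev cur [] = List.reverse cur ∷ []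
segmentsFrom prev cur (B′ ∷ Bs) =
  if B′ >D prev then List.reverse cur ∷ segmentsFrom B′ (B′ ∷ []) Bs else segmentsFrom B′ (B′ ∷ cur) Bs

segmentsGo≗segmentsFrom : ∀ {n} (B₀ : Block n) Bs₀ prev cur Bs →
  segmentsGo B₀ Bs₀ prev cur Bs ≡ segmentsFrom prev cur Bs
segmentsGo≗segmentsFrom B₀ Bs₀ prev cur [] = refl
segmentsGo≗segmentsFrom B₀ Bs₀ prev cur (B′ ∷ Bs) with B′ >D prev
... | true = cong (List.reverse cur ∷_) (segmentsGo≗segmentsFrom B₀ Bs₀ B′ (B′ ∷ []) Bs)
... | false = segmentsGo≗segmentsFrom B₀ Bs₀ B′ (B′ ∷ cur) Bs

segments≡segmentsFrom : ∀ {n} (B : Block n) Bs → segments (B ∷ Bs) ≡ segmentsFrom B (B ∷ []) Bs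
segments≡segmentsFrom B [] = refl
segments≡segmentsFrom B (B′ ∷ Bs) with segments-unfold B B′ Bs
... | unfold with B′ >D B
... | true = trans unfold (cong ((B ∷ []) ∷_) (segmentsGo≗segmentsFrom B (B′ ∷ Bs) B′ (B′ ∷ []) Bs))
... | false = trans unfold (segmentsGo≗segmentsFrom B (B′ ∷ Bs) B′ (B′ ∷ B ∷ []) Bs)

steps : {n : ℕ} → Block n → List (Block n) → List (Bool × ℕ)
steps prev [] = []
steps prev (B ∷ Bs) = (B >D prev , length B) ∷ steps B Bs

prependToHead : {A : Set} → List A → List (List A) → List (List A)
prependToHead R [] = []
prependToHead R (s ∷ S) = (R ++ s) ∷ S

prependToHead-[] : {A : Set} (S : List (List A)) → prependToHead [] S ≡ S
prependToHead-[] [] = refl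
prependToHead-[] (s ∷ S) = refl

prependToHead-++ : {A : Set} (R R′ : List A) (S : List (List A)) → prependToHead R (prependToHead R′ S) ≡ prependToHead (R ++ R′) S
prependToHead-++ R R′ [] = refl
prependToHead-++ R R′ (s ∷ S) = cong (_∷ S) (sym (List.++-assoc R R′ s))

segmentSizes : ℕ → List (Bool × ℕ) → List (List ℕ)
segmentSizes x [] = (x ∷ []) ∷ []
segmentSizes x ((e , y) ∷ ps) =
  if e then (x ∷ []) ∷ segmentSizes y ps else prependToHead (x ∷ []) (segmentSizes y ps)

map-length-reverse-∷ : ∀ {n} (B : Block n) Bs →
  map length (List.reverse (B ∷ Bs)) ≡ List.reverse (map length Bs) ++ length B ∷ []
map-length-reverse-∷ B Bs =
  trans (cong (map length) (List.unfold-reverse B Bs))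
  (trans (List.map-++ length (List.reverse Bs) (B ∷ [])) (cong (_++ length B ∷ []) (List.reverse-map length Bs)))

segmentsFrom-sizes : ∀ {n} (prev : Block n) cur Bs →
  map (map length) (segmentsFrom prev (prev ∷ cur) Bs)
    ≡ prependToHead (List.reverse (map length cur)) (segmentSizes (length prev) (steps prev Bs))
segmentsFrom-sizes prev cur [] = cong (_∷ []) (map-length-reverse-∷ prev cur)
segmentsFrom-sizes prev cur (B′ ∷ Bs) with B′ >D prev
... | true =
  cong₂ _∷_ (map-length-reverse-∷ prev cur) (trans (segmentsFrom-sizes B′ [] Bs) (prependToHead-[] _))
... | false =
  trans (segmentsFrom-sizes B′ (prev ∷ cur) Bs)
  (trans (cong (λ R → prependToHead R (segmentSizes (length B′) (steps B′ Bs)))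
               (List.unfold-reverse (length prev) (map length cur)))
         (sym (prependToHead-++ (List.reverse (map length cur)) (length prev ∷ []) _)))

segments-sizes : ∀ {n} (B : Block n) Bs → map (map length) (segments (B ∷ Bs)) ≡ segmentSizes (length B) (steps B Bs)
segments-sizes B Bs =
  trans (cong (map (map length)) (segments≡segmentsFrom B Bs))
  (trans (segmentsFrom-sizes B [] Bs) (prependToHead-[] _))

data Gap : Set where
  inner : Gap
  boundary : Bool → Gap

gaps : ℕ → List (Bool × ℕ) → List Gap
gaps x [] = replicate (pred x) inner
gaps x ((e , y) ∷ ps) = replicate (pred x) inner ++ boundary e ∷ gaps y ps

fillGaps : List Gap → List Bool → List Bool
fillGaps [] t = []
fillGaps (inner ∷ G) t = false ∷ fillGaps G t
fillGaps (boundary e ∷ G) [] = []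
fillGaps (boundary e ∷ G) (b ∷ t) = b ∷ fillGaps G t

ρI-cut : Gap → Bool
ρI-cut inner = true
ρI-cut (boundary e) = e

ρC-cut : Gap → Bool
ρC-cut inner = false
ρC-cut (boundary e) = e

Positive : ℕ → Set
Positive y = y ≡ suc (pred y)

PositiveSizes : List (Bool × ℕ) → Set
PositiveSizes = All (λ p → Positive (proj₂ p))

addToHead : ℕ → Composition → Composition
addToHead j [] = []
addToHead j (a ∷ γ) = (j + a) ∷ γ

glue : ℕ → List (Bool × ℕ) → List Bool → Composition
glue x [] t = x ∷ []
glue x (_ ∷ _) [] = x ∷ []
glue x ((e , y) ∷ ps) (b ∷ t) = if b then x ∷ glue y ps t else addToHead x (glue y ps t)

fillGaps-replicate-++ : ∀ j G t → fillGaps (replicate j inner ++ G) t ≡ replicate j false ++ fillGaps G t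
fillGaps-replicate-++ zero G t = refl
fillGaps-replicate-++ (suc j) G t = cong (false ∷_) (fillGaps-replicate-++ j G t)

fillGaps-replicate : ∀ j t → fillGaps (replicate j inner) t ≡ replicate j false
fillGaps-replicate zero t = refl
fillGaps-replicate (suc j) t = cong (false ∷_) (fillGaps-replicate j t)

fromCuts-replicate : ∀ j → fromCuts (replicate j false) ≡ suc j ∷ []
fromCuts-replicate zero = refl
fromCuts-replicate (suc j) = cong incHead (fromCuts-replicate j)

fromCuts-replicate-++ : ∀ j w → fromCuts (replicate j false ++ w) ≡ addToHead j (fromCuts w)
fromCuts-replicate-++ zero w with fromCuts-cons w
... | a , γ , e rewrite e = refl
fromCuts-replicate-++ (suc j) w with fromCuts-cons w | fromCuts-replicate-++ j w
... | a , γ , e | ih rewrite e | ih = refl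

fromCuts-fillGaps : ∀ x ps t → Positive x → PositiveSizes ps → length t ≡ length ps →
  fromCuts (fillGaps (gaps x ps) t) ≡ glue x ps t
fromCuts-fillGaps x [] t x>0 _ _ =
  trans (cong fromCuts (fillGaps-replicate (pred x) t))
  (trans (fromCuts-replicate (pred x)) (cong (_∷ []) (sym x>0)))
fromCuts-fillGaps x ((e , y) ∷ ps) (true ∷ t) x>0 (y>0 All.∷ ps>0) ∣t∣ =
  trans (cong fromCuts (fillGaps-replicate-++ (pred x) (boundary e ∷ gaps y ps) (true ∷ t)))
  (trans (fromCuts-replicate-++ (pred x) (true ∷ fillGaps (gaps y ps) t))
         (cong₂ _∷_ (trans (ℕ.+-comm (pred x) 1) (sym x>0))
                    (fromCuts-fillGaps y ps t y>0 ps>0 (ℕ.suc-injective ∣t∣))))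
fromCuts-fillGaps x ((e , y) ∷ ps) (false ∷ t) x>0 (y>0 All.∷ ps>0) ∣t∣
  with fromCuts-cons (fillGaps (gaps y ps) t) | fromCuts-fillGaps y ps t y>0 ps>0 (ℕ.suc-injective ∣t∣)
... | a , γ , eq | ih =
  trans (cong fromCuts (fillGaps-replicate-++ (pred x) (boundary e ∷ gaps y ps) (false ∷ t)))
  (trans (fromCuts-replicate-++ (pred x) (false ∷ fillGaps (gaps y ps) t))
  (trans (cong (λ γ′ → addToHead (pred x) (incHead γ′)) eq)
  (trans (cong (_∷ γ) (trans (ℕ.+-suc (pred x) (suc a)) (cong (_+ suc a) (sym x>0))))
         (cong (addToHead x) (trans (sym eq) ih)))))

map-sum-segmentSizes : ∀ x ps → map sum (segmentSizes x ps) ≡ glue x ps (map proj₁ ps)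
map-sum-segmentSizes x [] = cong (_∷ []) (ℕ.+-identityʳ x)
map-sum-segmentSizes x ((true , y) ∷ ps) = cong₂ _∷_ (ℕ.+-identityʳ x) (map-sum-segmentSizes y ps)
map-sum-segmentSizes x ((false , y) ∷ ps) with segmentSizes y ps | map-sum-segmentSizes y ps
... | [] | ih = cong (addToHead x) ih
... | s ∷ S | ih = cong (addToHead x) ih

map-ρC-cut-gaps : ∀ x ps → map ρC-cut (gaps x ps) ≡ fillGaps (gaps x ps) (map proj₁ ps)
map-ρC-cut-gaps x [] = trans (List.map-replicate ρC-cut (pred x) inner) (sym (fillGaps-replicate (pred x) []))
map-ρC-cut-gaps x ((e , y) ∷ ps) =
  trans (List.map-++ ρC-cut (replicate (pred x) inner) (boundary e ∷ gaps y ps))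
  (trans (cong₂ _++_ (List.map-replicate ρC-cut (pred x) inner) (cong (e ∷_) (map-ρC-cut-gaps y ps)))
         (sym (fillGaps-replicate-++ (pred x) (boundary e ∷ gaps y ps) (e ∷ map proj₁ ps))))

map-sum-segmentSizes≡fromCuts-ρC : ∀ x ps → Positive x → PositiveSizes ps →
  map sum (segmentSizes x ps) ≡ fromCuts (map ρC-cut (gaps x ps))
map-sum-segmentSizes≡fromCuts-ρC x ps x>0 ps>0 =
  trans (map-sum-segmentSizes x ps)
  (sym (trans (cong fromCuts (map-ρC-cut-gaps x ps))
              (fromCuts-fillGaps x ps (map proj₁ ps) x>0 ps>0 (List.length-map proj₁ ps))))

segmentCuts : ℕ → List (Bool × ℕ) → List (List Bool)
segmentCuts x [] = replicate (pred x) false ∷ []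
segmentCuts x ((e , y) ∷ ps) =
  if e then replicate (pred x) false ∷ segmentCuts y ps
  else prependToHead (replicate (pred x) false ++ true ∷ []) (segmentCuts y ps)

segmentCuts-cons : ∀ x ps → Σ (List Bool) λ v → Σ (List (List Bool)) λ vs → segmentCuts x ps ≡ v ∷ vs
segmentCuts-cons x [] = _ , _ , refl
segmentCuts-cons x ((true , y) ∷ ps) = _ , _ , refl
segmentCuts-cons x ((false , y) ∷ ps) with segmentCuts-cons y ps
... | v , vs , e rewrite e = _ , _ , refl

prependToHead-fromCuts : ∀ j vs →
  prependToHead (suc j ∷ []) (map fromCuts vs) ≡ map fromCuts (prependToHead (replicate j false ++ true ∷ []) vs)
prependToHead-fromCuts j [] = refl
prependToHead-fromCuts j (v ∷ vs) = cong (_∷ map fromCuts vs) (sym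
  (trans (cong fromCuts (List.++-assoc (replicate j false) (true ∷ []) v))
  (trans (fromCuts-replicate-++ j (true ∷ v)) (cong (_∷ fromCuts v) (ℕ.+-comm j 1)))))

segmentSizes≡fromCuts-segmentCuts : ∀ x ps → Positive x → PositiveSizes ps →
  segmentSizes x ps ≡ map fromCuts (segmentCuts x ps)
segmentSizes≡fromCuts-segmentCuts x [] x>0 _ =
  cong (_∷ []) (trans (cong (_∷ []) x>0) (sym (fromCuts-replicate (pred x))))
segmentSizes≡fromCuts-segmentCuts x ((true , y) ∷ ps) x>0 (y>0 All.∷ ps>0) =
  cong₂ _∷_ (trans (cong (_∷ []) x>0) (sym (fromCuts-replicate (pred x))))
            (segmentSizes≡fromCuts-segmentCuts y ps y>0 ps>0)
segmentSizes≡fromCuts-segmentCuts x ((false , y) ∷ ps) x>0 (y>0 All.∷ ps>0) =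
  trans (cong (prependToHead (x ∷ [])) (segmentSizes≡fromCuts-segmentCuts y ps y>0 ps>0))
  (trans (cong (λ z → prependToHead (z ∷ []) (map fromCuts (segmentCuts y ps))) x>0)
         (prependToHead-fromCuts (pred x) (segmentCuts y ps)))

concatMap-fromCuts : ∀ u us →
  concatMap fromCuts (u ∷ us) ≡ fromCuts (List.intercalate (true ∷ []) (u ∷ us))
concatMap-fromCuts u [] = List.++-identityʳ _
concatMap-fromCuts u (u′ ∷ us) = trans (cong (fromCuts u ++_) (concatMap-fromCuts u′ us)) (fromCuts-++ u _)

intercalate-complement-segmentCuts : ∀ x ps →
  List.intercalate (true ∷ []) (map (map not) (segmentCuts x ps)) ≡ map ρI-cut (gaps x ps)
intercalate-complement-segmentCuts x [] =
  trans (List.map-replicate not (pred x) false) (sym (List.map-replicate ρI-cut (pred x) inner))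
intercalate-complement-segmentCuts x ((true , y) ∷ ps)
  with segmentCuts-cons y ps | intercalate-complement-segmentCuts y ps
... | v , vs , e | ih rewrite e =
  trans (cong₂ _++_ (List.map-replicate not (pred x) false) (cong (true ∷_) ih))
  (sym (trans (List.map-++ ρI-cut (replicate (pred x) inner) (boundary true ∷ gaps y ps))
              (cong (_++ true ∷ map ρI-cut (gaps y ps)) (List.map-replicate ρI-cut (pred x) inner))))
intercalate-complement-segmentCuts x ((false , y) ∷ ps)
  with segmentCuts-cons y ps | intercalate-complement-segmentCuts y ps
... | v , vs , e | ih rewrite e = begin
  List.intercalate (true ∷ []) (map not (r ++ v) ∷ map (map not) vs)
    ≡⟨ cong (λ z → List.intercalate (true ∷ []) (z ∷ map (map not) vs)) (List.map-++ not r v) ⟩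
  List.intercalate (true ∷ []) ((map not r ++ map not v) ∷ map (map not) vs)
    ≡⟨ intercalate-++ (map not r) (map not v) (map (map not) vs) ⟩
  map not r ++ List.intercalate (true ∷ []) (map not v ∷ map (map not) vs)
    ≡⟨ cong₂ _++_ (trans (List.map-++ not (replicate (pred x) false) (true ∷ []))
                         (cong (_++ false ∷ []) (List.map-replicate not (pred x) false))) ih ⟩
  (replicate (pred x) true ++ false ∷ []) ++ map ρI-cut (gaps y ps)
    ≡⟨ List.++-assoc (replicate (pred x) true) (false ∷ []) _ ⟩
  replicate (pred x) true ++ false ∷ map ρI-cut (gaps y ps)
    ≡⟨ sym (trans (List.map-++ ρI-cut (replicate (pred x) inner) (boundary false ∷ gaps y ps))
                  (cong (_++ false ∷ map ρI-cut (gaps y ps)) (List.map-replicate ρI-cut (pred x) inner))) ⟩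
  map ρI-cut (gaps x ((false , y) ∷ ps)) ∎
  where
  open ≡-Reasoning
  r : List Bool
  r = replicate (pred x) false ++ true ∷ []
  intercalate-++ : ∀ p q ws → List.intercalate (true ∷ []) ((p ++ q) ∷ ws) ≡ p ++ List.intercalate (true ∷ []) (q ∷ ws)
  intercalate-++ p q [] = refl
  intercalate-++ p q (w ∷ ws) = List.++-assoc p q _

concatMap-complementC-segmentSizes : ∀ x ps → Positive x → PositiveSizes ps →
  concatMap complementC (segmentSizes x ps) ≡ fromCuts (map ρI-cut (gaps x ps))
concatMap-complementC-segmentSizes x ps x>0 ps>0 with segmentCuts-cons x ps | intercalate-complement-segmentCuts x ps
... | v , vs , e | joined = begin
  concatMap complementC (segmentSizes x ps)
    ≡⟨ cong (concatMap complementC) (segmentSizes≡fromCuts-segmentCuts x ps x>0 ps>0) ⟩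
  concatMap complementC (map fromCuts (segmentCuts x ps))
    ≡⟨ cong (List.concat) (trans (sym (List.map-∘ (segmentCuts x ps)))
         (trans (List.map-cong complementC-fromCuts (segmentCuts x ps)) (List.map-∘ (segmentCuts x ps)))) ⟩
  concatMap fromCuts (map (map not) (segmentCuts x ps))
    ≡⟨ cong (λ S → concatMap fromCuts (map (map not) S)) e ⟩
  concatMap fromCuts (map not v ∷ map (map not) vs)
    ≡⟨ concatMap-fromCuts (map not v) (map (map not) vs) ⟩
  fromCuts (List.intercalate (true ∷ []) (map (map not) (v ∷ vs)))
    ≡⟨ cong (λ S → fromCuts (List.intercalate (true ∷ []) (map (map not) S))) (sym e) ⟩
  fromCuts (List.intercalate (true ∷ []) (map (map not) (segmentCuts x ps)))
    ≡⟨ cong fromCuts joined ⟩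
  fromCuts (map ρI-cut (gaps x ps)) ∎
  where open ≡-Reasoning

length-gaps : ∀ x ps → Positive x → PositiveSizes ps → suc (length (gaps x ps)) ≡ x + sum (map proj₂ ps)
length-gaps x [] x>0 _ = trans (cong suc (List.length-replicate (pred x))) (trans (sym x>0) (sym (ℕ.+-identityʳ x)))
length-gaps x ((e , y) ∷ ps) x>0 (y>0 All.∷ ps>0) =
  trans (cong suc (List.length-++ (replicate (pred x) inner) {boundary e ∷ gaps y ps}))
  (trans (cong (λ z → suc (z + suc (length (gaps y ps)))) (List.length-replicate (pred x)))
  (trans (cong (λ z → suc (pred x + z)) (length-gaps y ps y>0 ps>0))
         (cong (_+ (y + sum (map proj₂ ps))) (sym x>0))))

-- Alternating sums over Boolean intervals

signAt : Bool → Bool → ℤ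
signAt false true = ℤ.-1ℤ
signAt _ _ = + 1

μ-product : List Bool → List Bool → ℤ
μ-product [] [] = + 1
μ-product (c ∷ C) (b ∷ a) = 𝟙 (c ⇒ᵇ b) *ℤ signAt c b *ℤ μ-product C a
μ-product _ _ = + 0

⊆ᵇ⇒#trues-≤ : ∀ C a → C ⊆ᵇ a ≡ true → #trues C ≤ #trues a
⊆ᵇ⇒#trues-≤ [] [] _ = z≤n
⊆ᵇ⇒#trues-≤ (true ∷ C) (true ∷ a) C⊆a = s≤s (⊆ᵇ⇒#trues-≤ C a C⊆a)
⊆ᵇ⇒#trues-≤ (false ∷ C) (true ∷ a) C⊆a = ℕ.m≤n⇒m≤1+n (⊆ᵇ⇒#trues-≤ C a C⊆a)
⊆ᵇ⇒#trues-≤ (false ∷ C) (false ∷ a) C⊆a = ⊆ᵇ⇒#trues-≤ C a C⊆a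

interval-sign≡μ-product : ∀ C a → 𝟙 (C ⊆ᵇ a) *ℤ (ℤ.-1ℤ ^ℤ (#trues a ∸ #trues C)) ≡ μ-product C a
interval-sign≡μ-product [] [] = refl
interval-sign≡μ-product [] (b ∷ a) = refl
interval-sign≡μ-product (c ∷ C) [] = refl
interval-sign≡μ-product (true ∷ C) (true ∷ a) = trans (interval-sign≡μ-product C a) (sym (ℤ.*-identityˡ _))
interval-sign≡μ-product (true ∷ C) (false ∷ a) = refl
interval-sign≡μ-product (false ∷ C) (false ∷ a) = trans (interval-sign≡μ-product C a) (sym (ℤ.*-identityˡ _))
interval-sign≡μ-product (false ∷ C) (true ∷ a) with C ⊆ᵇ a in C⊆a | interval-sign≡μ-product C a
... | true | ih rewrite ℕ.+-∸-assoc 1 (⊆ᵇ⇒#trues-≤ C a C⊆a) =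
  trans (regroup (ℤ.-1ℤ ^ℤ (#trues a ∸ #trues C))) (cong (λ z → + 1 *ℤ ℤ.-1ℤ *ℤ z) ih)
  where
  regroup : ∀ x → + 1 *ℤ (ℤ.-1ℤ *ℤ x) ≡ + 1 *ℤ ℤ.-1ℤ *ℤ (+ 1 *ℤ x)
  regroup = solve-∀
... | false | ih = sym (trans (cong (+ 1 *ℤ ℤ.-1ℤ *ℤ_) (sym ih)) (ℤ.*-zeroʳ (+ 1 *ℤ ℤ.-1ℤ)))

localTerm : Bool → Bool → Bool → Bool → ℤ
localTerm i c w b = 𝟙 (b ⇒ᵇ i) *ℤ (𝟙 (c ⇒ᵇ b) *ℤ signAt c b) *ℤ 𝟙 (b ⇒ᵇ w)

localTerms : List Bool → List Bool → List Bool → List Bool → ℤ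
localTerms [] [] [] [] = + 1
localTerms (i ∷ I) (c ∷ C) (w ∷ W) (b ∷ a) = localTerm i c w b *ℤ localTerms I C W a
localTerms _ _ _ _ = + 0

intervalTerm≡localTerms : ∀ I C W a → length C ≡ length I → length W ≡ length I → length a ≡ length I →
  𝟙 (a ⊆ᵇ I) *ℤ μ-product C a *ℤ 𝟙 (a ⊆ᵇ W) ≡ localTerms I C W a
intervalTerm≡localTerms [] [] [] [] _ _ _ = refl
intervalTerm≡localTerms (i ∷ I) (c ∷ C) (w ∷ W) (b ∷ a) ∣C∣ ∣W∣ ∣a∣ =
  trans (cong₂ (λ X Y → X *ℤ (𝟙 (c ⇒ᵇ b) *ℤ signAt c b *ℤ μ-product C a) *ℤ Y)
               (𝟙-∧ (b ⇒ᵇ i) (a ⊆ᵇ I)) (𝟙-∧ (b ⇒ᵇ w) (a ⊆ᵇ W)))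
  (trans (regroup (𝟙 (b ⇒ᵇ i)) (𝟙 (a ⊆ᵇ I)) (𝟙 (c ⇒ᵇ b) *ℤ signAt c b) (μ-product C a) (𝟙 (b ⇒ᵇ w)) (𝟙 (a ⊆ᵇ W)))
         (cong (localTerm i c w b *ℤ_)
               (intervalTerm≡localTerms I C W a (ℕ.suc-injective ∣C∣) (ℕ.suc-injective ∣W∣) (ℕ.suc-injective ∣a∣))))
  where
  regroup : ∀ x₁ x₂ y₁ y₂ z₁ z₂ → x₁ *ℤ x₂ *ℤ (y₁ *ℤ y₂) *ℤ (z₁ *ℤ z₂) ≡ x₁ *ℤ y₁ *ℤ z₁ *ℤ (x₂ *ℤ y₂ *ℤ z₂)
  regroup = solve-∀
intervalTerm≡localTerms [] [] (_ ∷ _) _ _ () _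
intervalTerm≡localTerms [] (_ ∷ _) _ _ () _ _
intervalTerm≡localTerms [] [] [] (_ ∷ _) _ _ ()
intervalTerm≡localTerms (i ∷ I) [] _ _ () _ _
intervalTerm≡localTerms (i ∷ I) (c ∷ C) [] _ _ () _
intervalTerm≡localTerms (i ∷ I) (c ∷ C) (w ∷ W) [] _ _ ()

localSums : List Bool → List Bool → List Bool → ℤ
localSums [] [] [] = + 1
localSums (i ∷ I) (c ∷ C) (w ∷ W) = (localTerm i c w true +ℤ localTerm i c w false) *ℤ localSums I C W
localSums _ _ _ = + 0

∑𝔹-localTerms : ∀ I C W → length C ≡ length I → length W ≡ length I →
  ∑𝔹 (length I) (localTerms I C W) ≡ localSums I C W
∑𝔹-localTerms [] [] [] _ _ = refl
∑𝔹-localTerms (i ∷ I) (c ∷ C) (w ∷ W) ∣C∣ ∣W∣ =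
  trans (∑𝔹-cong (length I) (λ v → sym (ℤ.*-distribʳ-+ (localTerms I C W v) (localTerm i c w true) (localTerm i c w false))))
  (trans (∑𝔹-*ˡ (length I) (localTerm i c w true +ℤ localTerm i c w false) (localTerms I C W))
         (cong ((localTerm i c w true +ℤ localTerm i c w false) *ℤ_) (∑𝔹-localTerms I C W (ℕ.suc-injective ∣C∣) (ℕ.suc-injective ∣W∣))))
∑𝔹-localTerms [] [] (_ ∷ _) _ ()
∑𝔹-localTerms [] (_ ∷ _) _ () _
∑𝔹-localTerms (i ∷ I) [] _ () _
∑𝔹-localTerms (i ∷ I) (c ∷ C) [] _ ()

boundaryWeight : Bool → Bool → ℤ
boundaryWeight true b = 𝟙 b
boundaryWeight false b = + 1

gapWeight : Gap → Bool → ℤ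
gapWeight inner b = 𝟙 (not b)
gapWeight (boundary e) b = boundaryWeight e b

gapWeights : List Gap → List Bool → ℤ
gapWeights [] [] = + 1
gapWeights (g ∷ G) (b ∷ w) = gapWeight g b *ℤ gapWeights G w
gapWeights _ _ = + 0

-- An inner gap gives Σ_{b ≤ w} (−1)^b = [¬ w]; at a boundary b = e is forced, giving [w] if e and 1 otherwise.
localSums≡gapWeights : ∀ G W → localSums (map ρI-cut G) (map ρC-cut G) W ≡ gapWeights G W
localSums≡gapWeights [] [] = refl
localSums≡gapWeights [] (_ ∷ _) = refl
localSums≡gapWeights (g ∷ G) [] = refl
localSums≡gapWeights (g ∷ G) (w ∷ W) = cong₂ _*ℤ_ (local g w) (localSums≡gapWeights G W)
  where
  local : ∀ g w → localTerm (ρI-cut g) (ρC-cut g) w true +ℤ localTerm (ρI-cut g) (ρC-cut g) w false ≡ gapWeight g w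
  local inner true = refl
  local inner false = refl
  local (boundary true) true = refl
  local (boundary true) false = refl
  local (boundary false) true = refl
  local (boundary false) false = refl

-- The summand is a product of one `localTerm` per gap, so the sum over a factorises.
∑𝔹-μ-product-gaps : ∀ G w → length w ≡ length G →
  ∑𝔹 (length G) (λ a → 𝟙 (a ⊆ᵇ map ρI-cut G) *ℤ μ-product (map ρC-cut G) a *ℤ 𝟙 (a ⊆ᵇ w)) ≡ gapWeights G w
∑𝔹-μ-product-gaps G w ∣w∣ = begin
  ∑𝔹 (length G) (λ a → 𝟙 (a ⊆ᵇ I) *ℤ μ-product C a *ℤ 𝟙 (a ⊆ᵇ w))
    ≡⟨ ∑𝔹-congᴸ (length G) (λ a ∣a∣ → intervalTerm≡localTerms I C w a ∣C∣ (trans ∣w∣ (sym ∣I∣)) (trans ∣a∣ (sym ∣I∣))) ⟩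
  ∑𝔹 (length G) (localTerms I C w)
    ≡⟨ cong (λ l → ∑𝔹 l (localTerms I C w)) (sym ∣I∣) ⟩
  ∑𝔹 (length I) (localTerms I C w)
    ≡⟨ ∑𝔹-localTerms I C w ∣C∣ (trans ∣w∣ (sym ∣I∣)) ⟩
  localSums I C w
    ≡⟨ localSums≡gapWeights G w ⟩
  gapWeights G w ∎
  where
  open ≡-Reasoning
  I C : List Bool
  I = map ρI-cut G
  C = map ρC-cut G
  ∣I∣ : length I ≡ length G
  ∣I∣ = List.length-map ρI-cut G
  ∣C∣ : length C ≡ length I
  ∣C∣ = trans (List.length-map ρC-cut G) (sym ∣I∣)

möbius-sum-gaps : ∀ (G : List Gap) (h : List Bool → ℤ) →
  ∑𝔹 (length G) (λ a → 𝟙 (a ⊆ᵇ map ρI-cut G ∧ map ρC-cut G ⊆ᵇ a) *ℤ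
    ((ℤ.-1ℤ ^ℤ (#trues a ∸ #trues (map ρC-cut G))) *ℤ ∑𝔹 (length G) (λ w → 𝟙 (a ⊆ᵇ w) *ℤ h w)))
  ≡ ∑𝔹 (length G) (λ w → h w *ℤ gapWeights G w)
möbius-sum-gaps G h = begin
  ∑𝔹 m (λ a → 𝟙 (a ⊆ᵇ I ∧ C ⊆ᵇ a) *ℤ ((ℤ.-1ℤ ^ℤ (#trues a ∸ #trues C)) *ℤ ∑𝔹 m (λ w → 𝟙 (a ⊆ᵇ w) *ℤ h w)))
    ≡⟨ ∑𝔹-cong m distribute ⟩
  ∑𝔹 m (λ a → ∑𝔹 m (λ w → h w *ℤ term a w))
    ≡⟨ ∑𝔹-swap m m (λ a w → h w *ℤ term a w) ⟩
  ∑𝔹 m (λ w → ∑𝔹 m (λ a → h w *ℤ term a w))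
    ≡⟨ ∑𝔹-congᴸ m (λ w ∣w∣ → trans (∑𝔹-*ˡ m (h w) (λ a → term a w)) (cong (h w *ℤ_) (∑𝔹-μ-product-gaps G w ∣w∣))) ⟩
  ∑𝔹 m (λ w → h w *ℤ gapWeights G w) ∎
  where
  open ≡-Reasoning
  m : ℕ
  m = length G
  I C : List Bool
  I = map ρI-cut G
  C = map ρC-cut G
  term : List Bool → List Bool → ℤ
  term a w = 𝟙 (a ⊆ᵇ I) *ℤ μ-product C a *ℤ 𝟙 (a ⊆ᵇ w)
  distribute : ∀ a → 𝟙 (a ⊆ᵇ I ∧ C ⊆ᵇ a) *ℤ ((ℤ.-1ℤ ^ℤ (#trues a ∸ #trues C)) *ℤ ∑𝔹 m (λ w → 𝟙 (a ⊆ᵇ w) *ℤ h w))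
    ≡ ∑𝔹 m (λ w → h w *ℤ term a w)
  distribute a =
    trans (cong (_*ℤ (sign *ℤ S)) (𝟙-∧ (a ⊆ᵇ I) (C ⊆ᵇ a)))
    (trans (regroup (𝟙 (a ⊆ᵇ I)) (𝟙 (C ⊆ᵇ a)) sign S)
    (trans (cong (λ z → 𝟙 (a ⊆ᵇ I) *ℤ z *ℤ S) (interval-sign≡μ-product C a))
    (trans (sym (∑𝔹-*ˡ m (𝟙 (a ⊆ᵇ I) *ℤ μ-product C a) (λ w → 𝟙 (a ⊆ᵇ w) *ℤ h w)))
           (∑𝔹-cong m (λ w → commute (𝟙 (a ⊆ᵇ I) *ℤ μ-product C a) (𝟙 (a ⊆ᵇ w)) (h w))))))
    where
    sign S : ℤ
    sign = ℤ.-1ℤ ^ℤ (#trues a ∸ #trues C)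
    S = ∑𝔹 m (λ w → 𝟙 (a ⊆ᵇ w) *ℤ h w)
    regroup : ∀ x y s S → x *ℤ y *ℤ (s *ℤ S) ≡ x *ℤ (y *ℤ s) *ℤ S
    regroup = solve-∀
    commute : ∀ u y g → u *ℤ (y *ℤ g) ≡ g *ℤ (u *ℤ y)
    commute = solve-∀

#boundaries : List Gap → ℕ
#boundaries [] = 0
#boundaries (inner ∷ G) = #boundaries G
#boundaries (boundary e ∷ G) = suc (#boundaries G)

boundaryWeights : List Gap → List Bool → ℤ
boundaryWeights [] [] = + 1
boundaryWeights [] (_ ∷ _) = + 0
boundaryWeights (inner ∷ G) t = boundaryWeights G t
boundaryWeights (boundary e ∷ G) [] = + 0
boundaryWeights (boundary e ∷ G) (b ∷ t) = boundaryWeight e b *ℤ boundaryWeights G t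

-- Inner gaps admit only w = false, so the sum runs over the values at the boundaries.
∑𝔹-gapWeights : ∀ G (h : List Bool → ℤ) →
  ∑𝔹 (length G) (λ w → h w *ℤ gapWeights G w) ≡ ∑𝔹 (#boundaries G) (λ t → boundaryWeights G t *ℤ h (fillGaps G t))
∑𝔹-gapWeights [] h = ℤ.*-comm (h []) (+ 1)
∑𝔹-gapWeights (inner ∷ G) h =
  trans (∑𝔹-cong (length G) (λ v → simplify (h (true ∷ v)) (h (false ∷ v)) (gapWeights G v)))
        (∑𝔹-gapWeights G (λ w → h (false ∷ w)))
  where
  simplify : ∀ x y k → x *ℤ (+ 0 *ℤ k) +ℤ y *ℤ (+ 1 *ℤ k) ≡ y *ℤ k
  simplify = solve-∀
∑𝔹-gapWeights (boundary e ∷ G) h = begin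
  ∑𝔹 (length G) (λ v → h (true ∷ v) *ℤ (at *ℤ gapWeights G v) +ℤ h (false ∷ v) *ℤ (af *ℤ gapWeights G v))
    ≡⟨ ∑𝔹-cong (length G) (λ v → regroup (h (true ∷ v)) (h (false ∷ v)) at af (gapWeights G v)) ⟩
  ∑𝔹 (length G) (λ v → at *ℤ (h (true ∷ v) *ℤ gapWeights G v) +ℤ af *ℤ (h (false ∷ v) *ℤ gapWeights G v))
    ≡⟨ ∑𝔹-+ (length G) _ _ ⟩
  ∑𝔹 (length G) (λ v → at *ℤ (h (true ∷ v) *ℤ gapWeights G v)) +ℤ
  ∑𝔹 (length G) (λ v → af *ℤ (h (false ∷ v) *ℤ gapWeights G v))
    ≡⟨ cong₂ _+ℤ_ (trans (∑𝔹-*ˡ (length G) at _) (cong (at *ℤ_) (∑𝔹-gapWeights G (λ w → h (true ∷ w)))))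
                  (trans (∑𝔹-*ˡ (length G) af _) (cong (af *ℤ_) (∑𝔹-gapWeights G (λ w → h (false ∷ w))))) ⟩
  at *ℤ ∑𝔹 k (λ t → boundaryWeights G t *ℤ h (true ∷ fillGaps G t)) +ℤ
  af *ℤ ∑𝔹 k (λ t → boundaryWeights G t *ℤ h (false ∷ fillGaps G t))
    ≡⟨ cong₂ _+ℤ_ (sym (∑𝔹-*ˡ k at _)) (sym (∑𝔹-*ˡ k af _)) ⟩
  ∑𝔹 k (λ t → at *ℤ (boundaryWeights G t *ℤ h (true ∷ fillGaps G t))) +ℤ
  ∑𝔹 k (λ t → af *ℤ (boundaryWeights G t *ℤ h (false ∷ fillGaps G t)))
    ≡⟨ sym (∑𝔹-+ k _ _) ⟩
  ∑𝔹 k (λ t → at *ℤ (boundaryWeights G t *ℤ h (true ∷ fillGaps G t)) +ℤ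
             af *ℤ (boundaryWeights G t *ℤ h (false ∷ fillGaps G t)))
    ≡⟨ ∑𝔹-cong k (λ t → cong₂ _+ℤ_ (sym (ℤ.*-assoc at _ _)) (sym (ℤ.*-assoc af _ _))) ⟩
  ∑𝔹 k (λ t → at *ℤ boundaryWeights G t *ℤ h (true ∷ fillGaps G t) +ℤ
             af *ℤ boundaryWeights G t *ℤ h (false ∷ fillGaps G t)) ∎
  where
  open ≡-Reasoning
  at af : ℤ
  at = boundaryWeight e true
  af = boundaryWeight e false
  k : ℕ
  k = #boundaries G
  regroup : ∀ x y a b g → x *ℤ (a *ℤ g) +ℤ y *ℤ (b *ℤ g) ≡ a *ℤ (x *ℤ g) +ℤ b *ℤ (y *ℤ g)
  regroup = solve-∀

-- LDD placements and column sizes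

Comparable : {n : ℕ} → Block n → List (Block n) → Set
Comparable prev [] = ⊤
Comparable prev (B ∷ Bs) = ((prev >D B) ≡ not (B >D prev)) × Comparable B Bs

nextColumn : ℕ → Bool → ℕ
nextColumn c b = if b then suc c else c

columnsFrom : ℕ → List Bool → List ℕ
columnsFrom c [] = []
columnsFrom c (b ∷ t) = nextColumn c b ∷ columnsFrom (nextColumn c b) t

length-columnsFrom : ∀ c t → length (columnsFrom c t) ≡ length t
length-columnsFrom c [] = refl
length-columnsFrom c (b ∷ t) = cong suc (length-columnsFrom (nextColumn c b) t)

choices : Bool → List Bool
choices true = true ∷ []
choices false = false ∷ true ∷ []

placements : List (Bool × ℕ) → List (List Bool)
placements [] = [] ∷ []
placements ((e , y) ∷ ps) = concatMap (λ b → map (b ∷_) (placements ps)) (choices e)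

allowedCols≡ : ∀ c {n} (B B′ : Block n) → (B >D B′) ≡ not (B′ >D B) →
  allowedCols c B B′ ≡ map (nextColumn c) (choices (B′ >D B))
allowedCols≡ c B B′ eq with B′ >D B
... | true rewrite eq = refl
... | false rewrite eq = refl

concatMap-map : ∀ {A B C : Set} (f : B → List C) (g : A → B) (h : A → List C) → (∀ a → f (g a) ≡ h a) →
  ∀ xs → concatMap f (map g xs) ≡ concatMap h xs
concatMap-map f g h f∘g≗h [] = refl
concatMap-map f g h f∘g≗h (a ∷ xs) = cong₂ _++_ (f∘g≗h a) (concatMap-map f g h f∘g≗h xs)

lddFrom≡ : ∀ c {n} (B : Block n) Bs → Comparable B Bs → lddFrom c B Bs ≡ map (columnsFrom c) (placements (steps B Bs))
lddFrom≡ c B [] _ = refl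
lddFrom≡ c B (B′ ∷ Bs) (eq , cmp) =
  trans (cong (concatMap (λ c′ → map (c′ ∷_) (lddFrom c′ B′ Bs))) (allowedCols≡ c B B′ eq))
  (trans (concatMap-map (λ c′ → map (c′ ∷_) (lddFrom c′ B′ Bs)) (nextColumn c)
            (λ b → map (columnsFrom c) (map (b ∷_) (placements (steps B′ Bs))))
            (λ b → trans (cong (map (nextColumn c b ∷_)) (lddFrom≡ (nextColumn c b) B′ Bs cmp))
                         (trans (sym (List.map-∘ (placements (steps B′ Bs)))) (List.map-∘ (placements (steps B′ Bs)))))
            (choices (B′ >D B)))
         (sym (List.map-concatMap (columnsFrom c) (λ b → map (b ∷_) (placements (steps B′ Bs))) (choices (B′ >D B)))))

LDD≡ : ∀ {n} (B : Block n) Bs → Comparable B Bs → LDD (B ∷ Bs) ≡ map (λ t → 1 ∷ columnsFrom 1 t) (placements (steps B Bs))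
LDD≡ B Bs cmp = trans (cong (map (1 ∷_)) (lddFrom≡ 1 B Bs cmp)) (sym (List.map-∘ (placements (steps B Bs))))

stepWeights : List (Bool × ℕ) → List Bool → ℤ
stepWeights [] [] = + 1
stepWeights ((e , y) ∷ ps) (b ∷ t) = boundaryWeight e b *ℤ stepWeights ps t
stepWeights _ _ = + 0

∑-placements : ∀ ps (h : List Bool → ℤ) → ∑ (placements ps) h ≡ ∑𝔹 (length ps) (λ t → stepWeights ps t *ℤ h t)
∑-placements [] h = trans (ℤ.+-identityʳ (h [])) (sym (ℤ.*-identityˡ (h [])))
∑-placements ((true , y) ∷ ps) h =
  trans (∑-concatMap (λ b → map (b ∷_) (placements ps)) (true ∷ []) h)
  (trans (ℤ.+-identityʳ _)
  (trans (∑-map (true ∷_) (placements ps) h)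
  (trans (∑-placements ps (λ t → h (true ∷ t)))
         (∑𝔹-cong (length ps) (λ t → expand (stepWeights ps t) (h (true ∷ t)) (h (false ∷ t)))))))
  where
  expand : ∀ a x y → a *ℤ x ≡ + 1 *ℤ a *ℤ x +ℤ + 0 *ℤ a *ℤ y
  expand = solve-∀
∑-placements ((false , y) ∷ ps) h =
  trans (∑-concatMap (λ b → map (b ∷_) (placements ps)) (false ∷ true ∷ []) h)
  (trans (cong₂ (λ X Y → X +ℤ (Y +ℤ + 0))
            (trans (∑-map (false ∷_) (placements ps) h) (∑-placements ps (λ t → h (false ∷ t))))
            (trans (∑-map (true ∷_) (placements ps) h) (∑-placements ps (λ t → h (true ∷ t)))))
  (trans (swap (∑𝔹 (length ps) (λ t → stepWeights ps t *ℤ h (false ∷ t))) (∑𝔹 (length ps) (λ t → stepWeights ps t *ℤ h (true ∷ t))))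
  (trans (sym (∑𝔹-+ (length ps) _ _))
         (∑𝔹-cong (length ps) (λ t → expand (stepWeights ps t) (h (true ∷ t)) (h (false ∷ t)))))))
  where
  expand : ∀ a x y → a *ℤ x +ℤ a *ℤ y ≡ + 1 *ℤ a *ℤ x +ℤ + 1 *ℤ a *ℤ y
  expand = solve-∀
  swap : ∀ X Y → X +ℤ (Y +ℤ + 0) ≡ Y +ℤ X
  swap = solve-∀

boundaryWeights-replicate-++ : ∀ j G t → boundaryWeights (replicate j inner ++ G) t ≡ boundaryWeights G t
boundaryWeights-replicate-++ zero G t = refl
boundaryWeights-replicate-++ (suc j) G t = boundaryWeights-replicate-++ j G t

boundaryWeights-gaps : ∀ x ps t → boundaryWeights (gaps x ps) t ≡ stepWeights ps t
boundaryWeights-gaps x [] t =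
  trans (cong (λ G → boundaryWeights G t) (sym (List.++-identityʳ (replicate (pred x) inner))))
  (trans (boundaryWeights-replicate-++ (pred x) [] t) (ends t))
  where
  ends : ∀ t → boundaryWeights [] t ≡ stepWeights [] t
  ends [] = refl
  ends (_ ∷ _) = refl
boundaryWeights-gaps x ((e , y) ∷ ps) [] = boundaryWeights-replicate-++ (pred x) _ []
boundaryWeights-gaps x ((e , y) ∷ ps) (b ∷ t) =
  trans (boundaryWeights-replicate-++ (pred x) _ (b ∷ t)) (cong (boundaryWeight e b *ℤ_) (boundaryWeights-gaps y ps t))

#boundaries-replicate-++ : ∀ j G → #boundaries (replicate j inner ++ G) ≡ #boundaries G
#boundaries-replicate-++ zero G = refl
#boundaries-replicate-++ (suc j) G = #boundaries-replicate-++ j G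

#boundaries-gaps : ∀ x ps → #boundaries (gaps x ps) ≡ length ps
#boundaries-gaps x [] =
  trans (cong #boundaries (sym (List.++-identityʳ (replicate (pred x) inner)))) (#boundaries-replicate-++ (pred x) [])
#boundaries-gaps x ((e , y) ∷ ps) = trans (#boundaries-replicate-++ (pred x) _) (cong suc (#boundaries-gaps y ps))

columnTotal : List ℕ → List ℕ → ℕ → ℕ
columnTotal (c ∷ cs) (s ∷ ss) j = (if does (c ℕ.≟ j) then s else 0) + columnTotal cs ss j
columnTotal _ _ j = 0

nonzero : ℕ → Bool
nonzero s = not (does (s ℕ.≟ 0))

nextColumn-≥ : ∀ c b → c ≤ nextColumn c b
nextColumn-≥ c true = ℕ.n≤1+n c
nextColumn-≥ c false = ℕ.≤-refl

columnTotal-< : ∀ c t ss j → j < c → columnTotal (c ∷ columnsFrom c t) ss j ≡ 0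
columnTotal-< c [] [] j j<c = refl
columnTotal-< c [] (s ∷ ss) j j<c rewrite dec-false (c ℕ.≟ j) (λ e → ℕ.<-irrefl (sym e) j<c) = refl
columnTotal-< c (b ∷ t) [] j j<c = refl
columnTotal-< c (b ∷ t) (s ∷ ss) j j<c rewrite dec-false (c ℕ.≟ j) (λ e → ℕ.<-irrefl (sym e) j<c) =
  columnTotal-< (nextColumn c b) t ss j (ℕ.<-≤-trans j<c (nextColumn-≥ c b))

map-cong-range : ∀ {f g : ℕ → ℕ} l c → (∀ j → c ≤ j → f j ≡ g j) → map f (range c l) ≡ map g (range c l)
map-cong-range zero c f≗g = refl
map-cong-range (suc l) c f≗g = cong₂ _∷_ (f≗g c ℕ.≤-refl) (map-cong-range l (suc c) (λ j c<j → f≗g j (ℕ.<⇒≤ c<j)))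

filterᵇ-nonzero-zeros : ∀ {f : ℕ → ℕ} l c → (∀ j → c ≤ j → f j ≡ 0) → List.filterᵇ nonzero (map f (range c l)) ≡ []
filterᵇ-nonzero-zeros zero c f≗0 = refl
filterᵇ-nonzero-zeros {f} (suc l) c f≗0 rewrite f≗0 c ℕ.≤-refl =
  filterᵇ-nonzero-zeros {f} l (suc c) (λ j c<j → f≗0 j (ℕ.<⇒≤ c<j))

other-column : ∀ c j x w → c < j → (if does (c ℕ.≟ j) then x else 0) + w ≡ w
other-column c j x w c<j rewrite dec-false (c ℕ.≟ j) (λ e → ℕ.<-irrefl e c<j) = refl

-- Placement t puts the blocks into the columns c, columnsFrom c t; the nonzero column totals are then
-- the block sizes glued across the boundaries where t stays in the same column.
columnTotals-glue : ∀ t c m x ps → Positive x → PositiveSizes ps → length t ≡ length ps → #trues t < m →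
  List.filterᵇ nonzero (map (columnTotal (c ∷ columnsFrom c t) (x ∷ map proj₂ ps)) (range c m)) ≡ glue x ps t
columnTotals-glue [] c (suc m) x [] x>0 _ _ _ rewrite dec-true (c ℕ.≟ c) refl | x>0 =
  cong₂ _∷_ (ℕ.+-identityʳ _) (filterᵇ-nonzero-zeros m (suc c) (λ j c<j → other-column c j (suc (pred x)) 0 c<j))
columnTotals-glue (true ∷ t) c (suc m) x ((e , y) ∷ ps) x>0 (y>0 All.∷ ps>0) ∣t∣ (s≤s #t<m)
  rewrite dec-true (c ℕ.≟ c) refl | columnTotal-< (suc c) t (y ∷ map proj₂ ps) c (ℕ.n<1+n c) | x>0 =
  cong₂ _∷_ (ℕ.+-identityʳ _)
    (trans (cong (List.filterᵇ nonzero) (map-cong-range m (suc c) (λ j c<j → other-column c j (suc (pred x)) _ c<j)))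
           (columnTotals-glue t (suc c) m y ps y>0 ps>0 (ℕ.suc-injective ∣t∣) #t<m))
columnTotals-glue (false ∷ t) c (suc m) x ((e , y) ∷ ps) x>0 (y>0 All.∷ ps>0) ∣t∣ #t<m
  with columnTotals-glue t c (suc m) y ps y>0 ps>0 (ℕ.suc-injective ∣t∣) #t<m
... | ih rewrite dec-true (c ℕ.≟ c) refl | x>0 | y>0 =
  trans (cong (λ R → (suc (pred x) + (suc (pred y) + columnTotal (columnsFrom c t) (map proj₂ ps) c))
                       ∷ List.filterᵇ nonzero R)
              (map-cong-range m (suc c) (λ j c<j → other-column c j (suc (pred x)) _ c<j)))
        (cong (addToHead (suc (pred x))) ih)
columnTotals-glue [] c (suc m) x ((e , y) ∷ ps) x>0 _ () _
columnTotals-glue (b ∷ t) c (suc m) x [] x>0 _ () _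
columnTotals-glue [] c zero x ps x>0 _ _ ()
columnTotals-glue (b ∷ t) c zero x ps x>0 _ _ ()

-- Blocks of a set composition

∑ᶠ : {k : ℕ} → (Fin k → ℕ) → ℕ
∑ᶠ = FinSum.sum

countᵇ : {A : Set} → (A → Bool) → List A → ℕ
countᵇ p [] = 0
countᵇ p (y ∷ ys) = (if p y then 1 else 0) + countᵇ p ys

length-filter≡countᵇ : {A : Set} {P : A → Set} (P? : Decidable P) (xs : List A) →
  length (filter P? xs) ≡ countᵇ (λ x → does (P? x)) xs
length-filter≡countᵇ P? [] = refl
length-filter≡countᵇ P? (x ∷ xs) with does (P? x)
... | true = cong suc (length-filter≡countᵇ P? xs)
... | false = length-filter≡countᵇ P? xs

countᵇ-true : {A : Set} (ys : List A) → countᵇ (λ _ → true) ys ≡ length ys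
countᵇ-true [] = refl
countᵇ-true (y ∷ ys) = cong suc (countᵇ-true ys)

∑ᶠ-zero : ∀ {k} (g : Fin k → ℕ) → (∀ i → g i ≡ 0) → ∑ᶠ g ≡ 0
∑ᶠ-zero {k} g g≗0 = trans (FinSum.sum-cong-≗ g≗0) (FinSum.sum-replicate-zero k)

∑ᶠ-indicator : ∀ {k} (z : Fin k) (g : Fin k → ℕ) → ∑ᶠ (λ i → if does (z Fin.≟ i) then g i else 0) ≡ g z
∑ᶠ-indicator Fin.zero g =
  trans (cong (λ r → g Fin.zero + r) (∑ᶠ-zero (λ i → if does (Fin.zero Fin.≟ Fin.suc i) then g (Fin.suc i) else 0) (λ i → refl)))
        (ℕ.+-identityʳ _)
∑ᶠ-indicator (Fin.suc z) g = ∑ᶠ-indicator z (λ i → g (Fin.suc i))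

count-fibres : ∀ {n k} (f : Fin n → Fin k) (D : Fin k → Bool) (ys : List (Fin n)) →
  countᵇ (λ y → D (f y)) ys ≡ ∑ᶠ (λ i → if D i then countᵇ (λ y → does (f y Fin.≟ i)) ys else 0)
count-fibres f D [] = sym (∑ᶠ-zero _ (λ i → if-same (D i)))
  where
  if-same : ∀ b → (if b then 0 else 0) ≡ 0
  if-same true = refl
  if-same false = refl
count-fibres f D (y ∷ ys) = sym (begin
  ∑ᶠ (λ i → if D i then (if does (f y Fin.≟ i) then 1 else 0) + countᵇ (λ y → does (f y Fin.≟ i)) ys else 0)
    ≡⟨ FinSum.sum-cong-≗ (λ i → split (does (f y Fin.≟ i)) (D i) _) ⟩
  ∑ᶠ (λ i → (if does (f y Fin.≟ i) then (if D i then 1 else 0) else 0) +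
            (if D i then countᵇ (λ y → does (f y Fin.≟ i)) ys else 0))
    ≡⟨ FinSum.∑-distrib-+ (λ i → if does (f y Fin.≟ i) then (if D i then 1 else 0) else 0)
                         (λ i → if D i then countᵇ (λ y → does (f y Fin.≟ i)) ys else 0) ⟩
  ∑ᶠ (λ i → if does (f y Fin.≟ i) then (if D i then 1 else 0) else 0) +
  ∑ᶠ (λ i → if D i then countᵇ (λ y → does (f y Fin.≟ i)) ys else 0)
    ≡⟨ cong₂ _+_ (∑ᶠ-indicator (f y) (λ i → if D i then 1 else 0)) (sym (count-fibres f D ys)) ⟩
  (if D (f y) then 1 else 0) + countᵇ (λ y → D (f y)) ys ∎)
  where
  open ≡-Reasoning
  split : ∀ b d c → (if d then (if b then 1 else 0) + c else 0) ≡ (if b then (if d then 1 else 0) else 0) + (if d then c else 0)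
  split true true c = refl
  split true false c = refl
  split false true c = refl
  split false false c = refl

length-block : ∀ {n k} (f : Fin n → Fin k) i → length (block f i) ≡ countᵇ (λ y → does (f y Fin.≟ i)) (List.allFin n)
length-block f i = length-filter≡countᵇ (λ x → f x Fin.≟ i) (List.allFin _)

∑ᶠ-columnTotal : ∀ {k} (g : Fin k → ℕ) cs j → length cs ≡ k →
  ∑ᶠ (λ i → if does (nth cs (toℕ i) ℕ.≟ j) then g i else 0) ≡ columnTotal cs (map g (List.allFin k)) j
∑ᶠ-columnTotal {zero} g [] j _ = refl
∑ᶠ-columnTotal {suc k} g (c ∷ cs) j ∣cs∣ =
  cong (λ r → (if does (c ℕ.≟ j) then g Fin.zero else 0) + r)
    (trans (∑ᶠ-columnTotal (λ i → g (Fin.suc i)) cs j (ℕ.suc-injective ∣cs∣))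
           (cong (λ L → columnTotal cs L j)
                 (trans (List.map-tabulate (λ i → i) (λ i → g (Fin.suc i))) (sym (List.map-tabulate Fin.suc g)))))

columnSize≡columnTotal : ∀ {n k} (f : Fin n → Fin k) (cs : List ℕ) j → length cs ≡ k →
  length (filter (λ x → nth cs (toℕ (f x)) ℕ.≟ j) (List.allFin n)) ≡ columnTotal cs (map length (blocks f)) j
columnSize≡columnTotal {n} {k} f cs j ∣cs∣ = begin
  length (filter (λ x → nth cs (toℕ (f x)) ℕ.≟ j) (List.allFin n))
    ≡⟨ length-filter≡countᵇ (λ x → nth cs (toℕ (f x)) ℕ.≟ j) (List.allFin n) ⟩
  countᵇ (λ x → does (nth cs (toℕ (f x)) ℕ.≟ j)) (List.allFin n)
    ≡⟨ count-fibres f (λ i → does (nth cs (toℕ i) ℕ.≟ j)) (List.allFin n) ⟩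
  ∑ᶠ (λ i → if does (nth cs (toℕ i) ℕ.≟ j) then countᵇ (λ y → does (f y Fin.≟ i)) (List.allFin n) else 0)
    ≡⟨ FinSum.sum-cong-≗ (λ i → cong (λ z → if does (nth cs (toℕ i) ℕ.≟ j) then z else 0) (sym (length-block f i))) ⟩
  ∑ᶠ (λ i → if does (nth cs (toℕ i) ℕ.≟ j) then length (block f i) else 0)
    ≡⟨ ∑ᶠ-columnTotal (λ i → length (block f i)) cs j ∣cs∣ ⟩
  columnTotal cs (map (λ i → length (block f i)) (List.allFin k)) j
    ≡⟨ cong (λ L → columnTotal cs L j) (List.map-∘ (List.allFin k)) ⟩
  columnTotal cs (map length (blocks f)) j ∎
  where open ≡-Reasoning

sum-map-allFin : ∀ {k} (g : Fin k → ℕ) → sum (map g (List.allFin k)) ≡ ∑ᶠ g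
sum-map-allFin {zero} g = refl
sum-map-allFin {suc k} g = cong (λ r → g Fin.zero + r)
  (trans (cong sum (trans (List.map-tabulate Fin.suc g) (sym (List.map-tabulate (λ i → i) (λ i → g (Fin.suc i))))))
         (sum-map-allFin (λ i → g (Fin.suc i))))

sum-blocks : ∀ {n k} (f : Fin n → Fin k) → sum (map length (blocks f)) ≡ n
sum-blocks {n} {k} f = begin
  sum (map length (blocks f))
    ≡⟨ cong sum (sym (List.map-∘ (List.allFin k))) ⟩
  sum (map (λ i → length (block f i)) (List.allFin k))
    ≡⟨ sum-map-allFin (λ i → length (block f i)) ⟩
  ∑ᶠ (λ i → length (block f i))
    ≡⟨ FinSum.sum-cong-≗ (length-block f) ⟩
  ∑ᶠ (λ i → countᵇ (λ y → does (f y Fin.≟ i)) (List.allFin n))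
    ≡⟨ sym (count-fibres f (λ _ → true) (List.allFin n)) ⟩
  countᵇ (λ _ → true) (List.allFin n)
    ≡⟨ countᵇ-true (List.allFin n) ⟩
  length (List.allFin n)
    ≡⟨ List.length-tabulate (λ i → i) ⟩
  n ∎
  where open ≡-Reasoning

<⇒Positive : ∀ {y} → 0 < y → Positive y
<⇒Positive (s≤s _) = refl

block-nonempty : ∀ {n k} (f : Fin n → Fin k) → IsSetComposition f → ∀ i → 0 < length (block f i)
block-nonempty f f-onto i with f-onto i
... | x , fx≡i = List.filter-some (λ y → f y Fin.≟ i) (Any.map (λ { refl → fx≡i }) (∈-allFin x))

block-head : ∀ {n k} (f : Fin n → Fin k) → IsSetComposition f → ∀ i →
  Σ (Fin n) λ h → Σ (List (Fin n)) λ rest → (block f i ≡ h ∷ rest) × (f h ≡ i)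
block-head f f-onto i with block f i in eq | block-nonempty f f-onto i
... | h ∷ rest | _ = h , rest , refl , proj₂ (∈-filter⁻ (λ y → f y Fin.≟ i) {xs = List.allFin _} (subst (h ∈_) (sym eq) (here refl)))

minB-block-injective : ∀ {n k} (f : Fin n → Fin k) → IsSetComposition f → ∀ i j →
  minB (block f i) ≡ minB (block f j) → i ≡ j
minB-block-injective f f-onto i j eq with block-head f f-onto i | block-head f f-onto j
... | h , _ , eh , fh≡i | h′ , _ , eh′ , fh′≡j rewrite eh | eh′ =
  trans (sym fh≡i) (trans (cong f (toℕ-injective eq)) fh′≡j)

<ᵇ-flip : ∀ p q → p ≢ q → (p ℕ.<ᵇ q) ≡ not (q ℕ.<ᵇ p)
<ᵇ-flip zero zero p≢q = ⊥-elim (p≢q refl)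
<ᵇ-flip zero (suc q) p≢q = refl
<ᵇ-flip (suc p) zero p≢q = refl
<ᵇ-flip (suc p) (suc q) p≢q = <ᵇ-flip p q (λ e → p≢q (cong suc e))

lexᵇ-flip : ∀ a b p q → p ≢ q →
  ((b ℕ.<ᵇ a) ∨ ((a ℕ.≡ᵇ b) ∧ (p ℕ.<ᵇ q))) ≡ not ((a ℕ.<ᵇ b) ∨ ((b ℕ.≡ᵇ a) ∧ (q ℕ.<ᵇ p)))
lexᵇ-flip zero zero p q p≢q = <ᵇ-flip p q p≢q
lexᵇ-flip zero (suc b) p q p≢q = refl
lexᵇ-flip (suc a) zero p q p≢q = refl
lexᵇ-flip (suc a) (suc b) p q p≢q = lexᵇ-flip a b p q p≢q

>D-flip : ∀ {n} (A B : Block n) → minB A ≢ minB B → (A >D B) ≡ not (B >D A)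
>D-flip A B = lexᵇ-flip (length A) (length B) (minB A) (minB B)

blocks-comparable : ∀ {n k} (f : Fin n → Fin k) → IsSetComposition f → ∀ i is →
  Linked _≢_ (i ∷ is) → Comparable (block f i) (map (block f) is)
blocks-comparable f f-onto i [] _ = tt
blocks-comparable f f-onto i (j ∷ is) (i≢j Linked.∷ linked) =
  >D-flip (block f i) (block f j) (λ e → i≢j (minB-block-injective f f-onto i j e)) ,
  blocks-comparable f f-onto j is linked

map-proj₂-steps : ∀ {n} (prev : Block n) Bs → map proj₂ (steps prev Bs) ≡ map length Bs
map-proj₂-steps prev [] = refl
map-proj₂-steps prev (B ∷ Bs) = cong (length B ∷_) (map-proj₂-steps B Bs)

length-steps : ∀ {n} (prev : Block n) Bs → length (steps prev Bs) ≡ length Bs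
length-steps prev [] = refl
length-steps prev (B ∷ Bs) = cong suc (length-steps B Bs)

steps-positive : ∀ {n k} (f : Fin n → Fin k) → IsSetComposition f → ∀ prev is →
  PositiveSizes (steps prev (map (block f) is))
steps-positive f f-onto prev [] = All.[]
steps-positive f f-onto prev (j ∷ is) =
  <⇒Positive (block-nonempty f f-onto j) All.∷ steps-positive f f-onto (block f j) is

-- Coefficients in the monomial basis

coeff-++ : ∀ γ xs ys → coeff γ (xs ++ ys) ≡ coeff γ xs +ℤ coeff γ ys
coeff-++ γ [] ys = sym (ℤ.+-identityˡ _)
coeff-++ γ ((c , δ) ∷ xs) ys =
  trans (cong (head +ℤ_) (coeff-++ γ xs ys)) (sym (ℤ.+-assoc head (coeff γ xs) (coeff γ ys)))
  where
  head : ℤ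
  head = if ⌊ δ ≟C γ ⌋ then c else + 0

coeff-concatMap : {A : Set} (γ : Composition) (h : A → QSym) (xs : List A) →
  coeff γ (concatMap h xs) ≡ ∑ xs (λ a → coeff γ (h a))
coeff-concatMap γ h [] = refl
coeff-concatMap γ h (a ∷ xs) = trans (coeff-++ γ (h a) (concatMap h xs)) (cong (coeff γ (h a) +ℤ_) (coeff-concatMap γ h xs))

coeff-scale : ∀ γ c xs → coeff γ (scale c xs) ≡ c *ℤ coeff γ xs
coeff-scale γ c [] = sym (ℤ.*-zeroʳ c)
coeff-scale γ c ((d , δ) ∷ xs) with ⌊ δ ≟C γ ⌋
... | true = trans (cong (c *ℤ d +ℤ_) (coeff-scale γ c xs)) (sym (ℤ.*-distribˡ-+ c d _))
... | false = trans (cong (+ 0 +ℤ_) (coeff-scale γ c xs))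
                    (trans (cong (_+ℤ (c *ℤ coeff γ xs)) (sym (ℤ.*-zeroʳ c))) (sym (ℤ.*-distribˡ-+ c (+ 0) _)))

#trues-≤-length : ∀ t → #trues t ≤ length t
#trues-≤-length [] = z≤n
#trues-≤-length (true ∷ t) = s≤s (#trues-≤-length t)
#trues-≤-length (false ∷ t) = ℕ.m≤n⇒m≤1+n (#trues-≤-length t)

∑-comps : ∀ m (h : Composition → ℤ) → ∑ (comps (suc m)) h ≡ ∑𝔹 m (λ a → h (fromCuts a))
∑-comps m h = trans (cong (λ γs → ∑ γs h) (comps-fromCuts m))
                    (trans (∑-map fromCuts (bitVectors m) h) (∑-bitVectors m (λ a → h (fromCuts a))))

coeff-F-fromCuts : ∀ γ m a → length a ≡ m →
  coeff γ (F (fromCuts a)) ≡ ∑𝔹 m (λ w → 𝟙 (a ⊆ᵇ w) *ℤ coeff γ (M (fromCuts w)))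
coeff-F-fromCuts γ m a ∣a∣ = begin
  coeff γ (F (fromCuts a))
    ≡⟨ coeff-concatMap γ M (filter (λ δ → (δ ≤ᵇ fromCuts a) Bool.≟ true) (comps (sum (fromCuts a)))) ⟩
  ∑ (filter (λ δ → (δ ≤ᵇ fromCuts a) Bool.≟ true) (comps (sum (fromCuts a)))) (λ δ → coeff γ (M δ))
    ≡⟨ ∑-filter (_≤ᵇ fromCuts a) (comps (sum (fromCuts a))) (λ δ → coeff γ (M δ)) ⟩
  ∑ (comps (sum (fromCuts a))) (λ δ → 𝟙 (δ ≤ᵇ fromCuts a) *ℤ coeff γ (M δ))
    ≡⟨ cong (λ s → ∑ (comps s) (λ δ → 𝟙 (δ ≤ᵇ fromCuts a) *ℤ coeff γ (M δ))) (trans (sum-fromCuts a) (cong suc ∣a∣)) ⟩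
  ∑ (comps (suc m)) (λ δ → 𝟙 (δ ≤ᵇ fromCuts a) *ℤ coeff γ (M δ))
    ≡⟨ ∑-comps m (λ δ → 𝟙 (δ ≤ᵇ fromCuts a) *ℤ coeff γ (M δ)) ⟩
  ∑𝔹 m (λ w → 𝟙 (fromCuts w ≤ᵇ fromCuts a) *ℤ coeff γ (M (fromCuts w)))
    ≡⟨ ∑𝔹-cong m (λ w → cong (λ b → 𝟙 b *ℤ coeff γ (M (fromCuts w))) (≤ᵇ-fromCuts w a)) ⟩
  ∑𝔹 m (λ w → 𝟙 (a ⊆ᵇ w) *ℤ coeff γ (M (fromCuts w))) ∎
  where open ≡-Reasoning

module _ {m k : ℕ} (f : Fin (suc m) → Fin (suc k)) (f-onto : IsSetComposition f) where

  private
    B₀ : Block (suc m)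
    B₀ = block f Fin.zero

    Bs : List (Block (suc m))
    Bs = map (block f) (List.tabulate Fin.suc)

    x : ℕ
    x = length B₀

    ps : List (Bool × ℕ)
    ps = steps B₀ Bs

    G : List Gap
    G = gaps x ps

    x>0 : Positive x
    x>0 = <⇒Positive (block-nonempty f f-onto Fin.zero)

    ps>0 : PositiveSizes ps
    ps>0 = steps-positive f f-onto B₀ (List.tabulate Fin.suc)

    ∣ps∣ : length ps ≡ k
    ∣ps∣ = trans (length-steps B₀ Bs) (trans (List.length-map (block f) (List.tabulate Fin.suc)) (List.length-tabulate Fin.suc))

    ∣G∣ : length G ≡ m
    ∣G∣ = ℕ.suc-injective (trans (length-gaps x ps x>0 ps>0)
            (trans (cong (λ L → x + sum L) (map-proj₂-steps B₀ Bs)) (sum-blocks f)))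

    ρcol-glue : ∀ t → length t ≡ length ps → ρcol f (1 ∷ columnsFrom 1 t) ≡ glue x ps t
    ρcol-glue t ∣t∣ = begin
      ρcol f cs
        ≡⟨ filter-does (λ s → ¬? (s ℕ.≟ 0)) (map columnSize (map suc (List.upTo (suc k)))) ⟩
      List.filterᵇ nonzero (map columnSize (map suc (List.upTo (suc k))))
        ≡⟨ cong (List.filterᵇ nonzero) (trans (cong (map columnSize) (map-suc-upTo (suc k)))
                                              (List.map-cong (λ j → columnSize≡columnTotal f cs j ∣cs∣) (range 1 (suc k)))) ⟩
      List.filterᵇ nonzero (map (columnTotal cs (map length (blocks f))) (range 1 (suc k)))
        ≡⟨ cong (λ S → List.filterᵇ nonzero (map (columnTotal cs S) (range 1 (suc k))))
                (cong (x ∷_) (sym (map-proj₂-steps B₀ Bs))) ⟩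
      List.filterᵇ nonzero (map (columnTotal cs (x ∷ map proj₂ ps)) (range 1 (suc k)))
        ≡⟨ columnTotals-glue t 1 (suc k) x ps x>0 ps>0 ∣t∣ (s≤s (ℕ.≤-trans (#trues-≤-length t) (ℕ.≤-reflexive (trans ∣t∣ ∣ps∣)))) ⟩
      glue x ps t ∎
      where
      open ≡-Reasoning
      cs : List ℕ
      cs = 1 ∷ columnsFrom 1 t
      columnSize : ℕ → ℕ
      columnSize j = length (filter (λ y → nth cs (toℕ (f y)) ℕ.≟ j) (List.allFin (suc m)))
      ∣cs∣ : length cs ≡ suc k
      ∣cs∣ = cong suc (trans (length-columnsFrom 1 t) (trans ∣t∣ ∣ps∣))

    comparable : Comparable B₀ Bs
    comparable = blocks-comparable f f-onto Fin.zero (List.tabulate Fin.suc) (AllPairs⇒Linked (allFin⁺ (suc k)))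

    ρC≡fromCuts : ρC f ≡ fromCuts (map ρC-cut G)
    ρC≡fromCuts = trans (cong (map sum) (segments-sizes B₀ Bs)) (map-sum-segmentSizes≡fromCuts-ρC x ps x>0 ps>0)

    ρI≡fromCuts : ρI f ≡ fromCuts (map ρI-cut G)
    ρI≡fromCuts = trans (cong (concatMap complementC) (segments-sizes B₀ Bs))
                        (concatMap-complementC-segmentSizes x ps x>0 ps>0)

    I C : List Bool
    I = map ρI-cut G
    C = map ρC-cut G

    rhs-summand : ∀ γ a → length a ≡ m →
      𝟙 ((ρI f ≤ᵇ fromCuts a) ∧ (fromCuts a ≤ᵇ ρC f)) *ℤ coeff γ (scale (μ (fromCuts a) (ρC f)) (F (fromCuts a)))
      ≡ 𝟙 (a ⊆ᵇ I ∧ C ⊆ᵇ a) *ℤ ((ℤ.-1ℤ ^ℤ (#trues a ∸ #trues C)) *ℤ ∑𝔹 m (λ w → 𝟙 (a ⊆ᵇ w) *ℤ coeff γ (M (fromCuts w))))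
    rhs-summand γ a ∣a∣ rewrite ρC≡fromCuts | ρI≡fromCuts =
      cong₂ _*ℤ_ (cong 𝟙 (cong₂ _∧_ (≤ᵇ-fromCuts I a) (≤ᵇ-fromCuts a C)))
        (trans (coeff-scale γ (μ (fromCuts a) (fromCuts C)) (F (fromCuts a)))
               (cong₂ _*ℤ_ (cong₂ (λ p q → ℤ.-1ℤ ^ℤ (p ∸ q)) (length-fromCuts a) (length-fromCuts C))
                           (coeff-F-fromCuts γ m a ∣a∣)))

  -- Both sides of the theorem reduce to this sum over the choices at the block boundaries.
  boundarySum : Composition → ℤ
  boundarySum γ = ∑𝔹 (length ps) (λ t → stepWeights ps t *ℤ coeff γ (M (fromCuts (fillGaps G t))))

  coeff-ρP : ∀ γ → coeff γ (ρP f) ≡ boundarySum γ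
  coeff-ρP γ = begin
    coeff γ (ρP f)
      ≡⟨ coeff-concatMap γ (λ cs → M (ρcol f cs)) (LDD (blocks f)) ⟩
    ∑ (LDD (B₀ ∷ Bs)) (λ cs → coeff γ (M (ρcol f cs)))
      ≡⟨ cong (λ css → ∑ css (λ cs → coeff γ (M (ρcol f cs)))) (LDD≡ B₀ Bs comparable) ⟩
    ∑ (map (λ t → 1 ∷ columnsFrom 1 t) (placements ps)) (λ cs → coeff γ (M (ρcol f cs)))
      ≡⟨ ∑-map (λ t → 1 ∷ columnsFrom 1 t) (placements ps) (λ cs → coeff γ (M (ρcol f cs))) ⟩
    ∑ (placements ps) (λ t → coeff γ (M (ρcol f (1 ∷ columnsFrom 1 t))))
      ≡⟨ ∑-placements ps (λ t → coeff γ (M (ρcol f (1 ∷ columnsFrom 1 t)))) ⟩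
    ∑𝔹 (length ps) (λ t → stepWeights ps t *ℤ coeff γ (M (ρcol f (1 ∷ columnsFrom 1 t))))
      ≡⟨ ∑𝔹-congᴸ (length ps) (λ t ∣t∣ → cong (λ δ → stepWeights ps t *ℤ coeff γ (M δ))
           (trans (ρcol-glue t ∣t∣) (sym (fromCuts-fillGaps x ps t x>0 ps>0 ∣t∣)))) ⟩
    boundarySum γ ∎
    where open ≡-Reasoning

  coeff-rhs : ∀ γ → coeff γ (rhs f) ≡ boundarySum γ
  coeff-rhs γ = begin
    coeff γ (rhs f)
      ≡⟨ coeff-concatMap γ (λ α → scale (μ α (ρC f)) (F α)) (filter (λ α → inRange α Bool.≟ true) (comps (suc m))) ⟩
    ∑ (filter (λ α → inRange α Bool.≟ true) (comps (suc m))) (λ α → coeff γ (scale (μ α (ρC f)) (F α)))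
      ≡⟨ ∑-filter inRange (comps (suc m)) (λ α → coeff γ (scale (μ α (ρC f)) (F α))) ⟩
    ∑ (comps (suc m)) (λ α → 𝟙 (inRange α) *ℤ coeff γ (scale (μ α (ρC f)) (F α)))
      ≡⟨ ∑-comps m (λ α → 𝟙 (inRange α) *ℤ coeff γ (scale (μ α (ρC f)) (F α))) ⟩
    ∑𝔹 m (λ a → 𝟙 (inRange (fromCuts a)) *ℤ coeff γ (scale (μ (fromCuts a) (ρC f)) (F (fromCuts a))))
      ≡⟨ ∑𝔹-congᴸ m (rhs-summand γ) ⟩
    ∑𝔹 m (λ a → 𝟙 (a ⊆ᵇ I ∧ C ⊆ᵇ a) *ℤ ((ℤ.-1ℤ ^ℤ (#trues a ∸ #trues C)) *ℤ ∑𝔹 m (λ w → 𝟙 (a ⊆ᵇ w) *ℤ h w)))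
      ≡⟨ cong (λ l → ∑𝔹 l (λ a → 𝟙 (a ⊆ᵇ I ∧ C ⊆ᵇ a) *ℤ ((ℤ.-1ℤ ^ℤ (#trues a ∸ #trues C)) *ℤ ∑𝔹 l (λ w → 𝟙 (a ⊆ᵇ w) *ℤ h w))))
              (sym ∣G∣) ⟩
    ∑𝔹 (length G) (λ a → 𝟙 (a ⊆ᵇ I ∧ C ⊆ᵇ a) *ℤ ((ℤ.-1ℤ ^ℤ (#trues a ∸ #trues C)) *ℤ ∑𝔹 (length G) (λ w → 𝟙 (a ⊆ᵇ w) *ℤ h w)))
      ≡⟨ möbius-sum-gaps G h ⟩
    ∑𝔹 (length G) (λ w → h w *ℤ gapWeights G w)
      ≡⟨ ∑𝔹-gapWeights G h ⟩
    ∑𝔹 (#boundaries G) (λ t → boundaryWeights G t *ℤ h (fillGaps G t))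
      ≡⟨ cong (λ l → ∑𝔹 l (λ t → boundaryWeights G t *ℤ h (fillGaps G t))) (#boundaries-gaps x ps) ⟩
    ∑𝔹 (length ps) (λ t → boundaryWeights G t *ℤ h (fillGaps G t))
      ≡⟨ ∑𝔹-cong (length ps) (λ t → cong (_*ℤ h (fillGaps G t)) (boundaryWeights-gaps x ps t)) ⟩
    boundarySum γ ∎
    where
    open ≡-Reasoning
    inRange : Composition → Bool
    inRange α = (ρI f ≤ᵇ α) ∧ (α ≤ᵇ ρC f)
    h : List Bool → ℤ
    h w = coeff γ (M (fromCuts w))

theorem4p9 : (n k : ℕ) (Φ : Fin n → Fin k) → IsSetComposition Φ →
             (γ : Composition) → coeff γ (ρP Φ) ≡ coeff γ (rhs Φ)
theorem4p9 zero zero Φ _ γ = refl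
theorem4p9 zero (suc k) Φ Φ-onto γ with Φ-onto Fin.zero
... | () , _
theorem4p9 (suc m) zero Φ _ γ with Φ Fin.zero
... | ()
theorem4p9 (suc m) (suc k) Φ Φ-onto γ = trans (coeff-ρP Φ Φ-onto γ) (sym (coeff-rhs Φ Φ-onto γ))
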